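{- Let $A_1,A_2,\ldots$ be the sequence of matrices defined by \[ A_1=\begin{bmatrix}1&0\\0&1\end{bmatrix},\qquad B=\begin{bmatrix}1&-1\\-1&-1\end{bmatrix},\qquad A_{k+1}=\tfrac12\left((2A_k-J_{2^k})\otimes B+J_{2^{k+1}}\right)\ (k\geq1). \] Then for every $k\geq 1$, all row sums of $A_{k+1}$ are equal to $2^k$, and the spectrum of $A_{k+1}$ is: $2^k$ with multiplicity $1$, $2^{k/2}$ with multiplicity $2^{k-1}$, $0$ with multiplicity $2^k-1$, and $-2^{k/2}$ with multiplicity $2^{k-1}$.
   Context: $J_m$ denotes the $m\times m$ all-ones matrix and $\otimes$ denotes the Kronecker product. Each $A_k$ is a symmetric $(0,1)$-matrix of order $2^k$. -}

module Defs where

open import Data.Nat as ℕ using (ℕ; zero; suc)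
open import Data.Nat.Properties using (*-comm)
open import Data.Integer using (ℤ; +_; -_; _+_; _-_; _*_)
open import Data.Integer.DivMod using (_/_)
open import Data.Fin using (Fin; zero; suc; cast; remQuot; punchIn; _≟_)
open import Data.Product using (_,_)
open import Data.List using (List; []; _∷_; map)
open import Relation.Nullary using (yes; no)
open import Relation.Binary.PropositionalEquality using (_≡_)

Mat : ℕ → Set
Mat n = Fin n → Fin n → ℤ

J : (n : ℕ) → Mat n
J n i j = + 1

B : Mat 2
B zero    zero    = + 1
B zero    (suc _) = - (+ 1)
B (suc _) zero    = - (+ 1)
B (suc _) (suc _) = - (+ 1)

I : (n : ℕ) → Mat n
I n i j with i ≟ j
... | yes _ = + 1
... | no  _ = + 0

-- Kronecker product: row/column index i * n + p  ↦  (i , p)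
_⊗_ : {m n : ℕ} → Mat m → Mat n → Mat (m ℕ.* n)
_⊗_ {m} {n} M N r c with remQuot {m} n r | remQuot {m} n c
... | i , p | j , q = M i j * N p q

castMat : {m n : ℕ} → m ≡ n → Mat m → Mat n
castMat {m} {n} e M i j = M (cast (Relation.Binary.PropositionalEquality.sym e) i)
                            (cast (Relation.Binary.PropositionalEquality.sym e) j)

-- The sequence A_1, A_2, ... ;  Aseq k  denotes  A_{k+1}, of order 2^(k+1).
--   A_1 = I_2,
--   A_{k+1} = 1/2 ((2 A_k - J) ⊗ B + J)   (entries are integers, so exact /2)

Aseq : (k : ℕ) → Mat (2 ℕ.^ suc k)
Aseq zero = I 2
Aseq (suc k) =
  castMat (*-comm (2 ℕ.^ suc k) 2)
    (λ r c → ((((λ i j → + 2 * Aseq k i j - J _ i j) ⊗ B) r c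
               + J (2 ℕ.^ suc k ℕ.* 2) r c) / + 2))

sumℤ : {n : ℕ} → (Fin n → ℤ) → ℤ
sumℤ {zero}  f = + 0
sumℤ {suc n} f = f zero + sumℤ (λ i → f (suc i))

rowSum : {n : ℕ} → Mat n → Fin n → ℤ
rowSum M i = sumℤ (M i)

-- Polynomials over ℤ as little-endian coefficient lists.

Poly : Set
Poly = List ℤ

_+P_ : Poly → Poly → Poly
[]      +P q       = q
(a ∷ p) +P []      = a ∷ p
(a ∷ p) +P (b ∷ q) = (a + b) ∷ (p +P q)

scaleP : ℤ → Poly → Poly
scaleP a = map (a *_)

_*P_ : Poly → Poly → Poly
[]      *P q = []
(a ∷ p) *P q = scaleP a q +P (+ 0 ∷ (p *P q))

negP : Poly → Poly
negP = scaleP (- (+ 1))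

_-P_ : Poly → Poly → Poly
p -P q = p +P negP q

constP : ℤ → Poly
constP a = a ∷ []

Xp : Poly
Xp = + 0 ∷ + 1 ∷ []

_^P_ : Poly → ℕ → Poly
p ^P zero  = constP (+ 1)
p ^P suc n = p *P (p ^P n)

coeff : Poly → ℕ → ℤ
coeff []      _       = + 0
coeff (a ∷ p) zero    = a
coeff (a ∷ p) (suc i) = coeff p i

-- equality of polynomials (coefficientwise; ignores trailing zeros)
_≈P_ : Poly → Poly → Set
p ≈P q = ∀ i → coeff p i ≡ coeff q i

sign : {n : ℕ} → Fin n → ℤ
sign zero    = + 1
sign (suc j) = - (sign j)

sumP : {n : ℕ} → (Fin n → Poly) → Poly
sumP {zero}  f = []
sumP {suc n} f = f zero +P sumP (λ i → f (suc i))

det : (n : ℕ) → (Fin n → Fin n → Poly) → Poly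
det zero    M = constP (+ 1)
det (suc n) M =
  sumP (λ j → scaleP (sign j)
                (M zero j *P det n (λ r c → M (suc r) (punchIn j c))))

charPoly : {n : ℕ} → Mat n → Poly
charPoly {n} M = det n (λ i j → (scaleP (I n i j) Xp) -P constP (M i j))

-- Write A_{k+1} = (J + C₂ ⊗ G_k) / 2 with C₂ = 2 I - J₂ and G_k = B^{⊗k}; since the rows of C₂ sum
-- to 0, every row of A_{k+1} sums to 2^k. Conjugating x I - A_{k+1} by H₂ ⊗ I, with H₂ the 2 × 2
-- Hadamard matrix, splits it into the blocks x I - J and x I - G_k, so its determinant is
-- x^(2^k - 1) (x - 2^k) · det (x I - G_k). As G_k = B ⊗ G_{k-1} with G_{k-1}² = 2^(k-1) I and all
-- blocks of x I - G_k commute, a Schur complement gives det (x I - G_k) = (x² - 2^k)^(2^(k-1)).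
-- Over ℤ the Schur complement needs a block of nonzero determinant, which holds at odd x; and two
-- integer polynomials that agree at all odd integers are equal.

module Submission where

open import Defs
open import Data.Nat as ℕ using (ℕ; suc; _≤_; _∸_)
open import Data.Integer using (+_)
open import Data.Fin using (Fin)
open import Data.Product using (_×_)
open import Relation.Binary.PropositionalEquality using (_≡_)

open import Data.Nat using (zero; z≤n; s≤s)
import Data.Nat.Properties as ℕP
open import Data.Integer as ℤ using (ℤ; -_; _+_; _-_; _*_; _^_; ∣_∣)
import Data.Integer.Properties as ℤP
open import Data.Integer.Solver using (module +-*-Solver)
open import Data.Integer.DivMod using (_/_; _%_; a≡a%n+[a/n]*n; n%d<d)
open import Data.Fin as Fin
  using (zero; suc; punchIn; punchOut; toℕ; inject₁; fromℕ<; _↑ˡ_; _↑ʳ_; combine; remQuot; cast)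
open import Data.Fin.Properties
  using ( punchInᵢ≢i; punchIn-injective; punchIn-punchOut; punchOut-injective; suc-injective
        ; toℕ-injective; toℕ-inject₁; toℕ-fromℕ<; toℕ<n; toℕ-cast; toℕ-↑ˡ; cast-is-id; any?; pigeonhole; <⇒≢
        ; remQuot-combine; combine-surjective; combine-injectiveˡ; combine-injectiveʳ; toℕ-combine; cast-involutive )
open import Data.Fin.Permutation.Components using (transpose)
open import Data.Fin.Patterns using (0F; 1F)
open import Data.Product using (Σ; _,_; proj₁; proj₂; ∃₂)
open import Data.List using ([]; _∷_)
open import Data.Empty using (⊥-elim)
open import Data.Sum using (_⊎_; inj₁; inj₂)
open import Function using (_∘_)
open import Data.Vec.Functional using (updateAt)
open import Data.Vec.Functional.Properties using (updateAt-updates; updateAt-minimal)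
open import Relation.Nullary using (Dec; yes; no; ¬_)
open import Relation.Nullary.Decidable using (dec-true; dec-false)
open import Relation.Binary using (tri<; tri≈; tri>)
open import Relation.Binary.PropositionalEquality
  using (refl; sym; trans; cong; cong₂; subst; _≢_; module ≡-Reasoning)
open import Algebra.Properties.CommutativeMonoid.Sum ℤP.+-0-commutativeMonoid
  using (sum; sum-syntax; sum-cong-≗; sum-replicate-zero; sum-remove; ∑-distrib-+; ∑-comm)
open import Algebra.Properties.Semiring.Sum ℤP.+-*-semiring using (*-distribˡ-sum)

open +-*-Solver

x+y≡0∧y≡0⇒x≡0 : ∀ {x y : ℤ} → x + y ≡ + 0 → y ≡ + 0 → x ≡ + 0
x+y≡0∧y≡0⇒x≡0 {x} x+y≡0 refl = trans (sym (ℤP.+-identityʳ x)) x+y≡0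

*-cancelˡ-≢0 : ∀ {a b c : ℤ} → a ≢ + 0 → a * b ≡ a * c → b ≡ c
*-cancelˡ-≢0 {a} {b} {c} a≢0 = ℤP.*-cancelˡ-≡ a b c {{ℤ.≢-nonZero a≢0}}

^≢0 : ∀ {a : ℤ} n → a ≢ + 0 → a ^ n ≢ + 0
^≢0 {a} n a≢0 = a≢0 ∘ ℤP.i^n≡0⇒i≡0 a n

+[2^k]≡[+2]^k : ∀ k → + (2 ℕ.^ k) ≡ (+ 2) ^ k
+[2^k]≡[+2]^k zero    = refl
+[2^k]≡[+2]^k (suc k) = trans (ℤP.pos-* 2 (2 ℕ.^ k)) (cong (+ 2 *_) (+[2^k]≡[+2]^k k))

odd : ℤ → ℤ
odd y = + 1 + + 2 * y

odd≢0 : ∀ y → odd y ≢ + 0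
odd≢0 y odd≡0 = ℕP.even≢odd ∣ y ∣ 0 (begin
  2 ℕ.* ∣ y ∣       ≡⟨ ℤP.abs-* (+ 2) y ⟨
  ∣ + 2 * y ∣       ≡⟨ cong ∣_∣ 2y≡-1 ⟩
  1                 ∎)
  where
  open ≡-Reasoning
  2y≡-1 : + 2 * y ≡ - + 1
  2y≡-1 = trans (solve 1 (λ y → con (+ 2) :* y := (con (+ 1) :+ con (+ 2) :* y) :- con (+ 1)) refl y)
                (cong (_- + 1) odd≡0)

[2*z]/2≡z : ∀ z → (+ 2 * z) / + 2 ≡ z
[2*z]/2≡z z with (+ 2 * z) % + 2 | a≡a%n+[a/n]*n (+ 2 * z) (+ 2) | n%d<d (+ 2 * z) (+ 2)
... | 0 | 2z≡q*2 | _ =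
  *-cancelˡ-≢0 {+ 2} (λ ()) (sym (trans 2z≡q*2 (trans (ℤP.+-identityˡ _) (ℤP.*-comm ((+ 2 * z) / + 2) (+ 2)))))
... | 1 | 2z≡1+q*2 | _ = ⊥-elim (odd≢0 (q - z) (begin
  + 1 + + 2 * (q - z)
    ≡⟨ solve 2 (λ z q → con (+ 1) :+ con (+ 2) :* (q :- z) := (con (+ 1) :+ q :* con (+ 2)) :- con (+ 2) :* z) refl z q ⟩
  (+ 1 + q * + 2) - + 2 * z      ≡⟨ cong (_- + 2 * z) 2z≡1+q*2 ⟨
  + 2 * z - + 2 * z              ≡⟨ ℤP.+-inverseʳ (+ 2 * z) ⟩
  + 0                            ∎))
  where
  open ≡-Reasoning
  q = (+ 2 * z) / + 2
... | suc (suc r) | _ | s≤s (s≤s ())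

2*[n/2]≡n : ∀ {n} w → n ≡ + 2 * w → + 2 * (n / + 2) ≡ n
2*[n/2]≡n w refl = cong (+ 2 *_) ([2*z]/2≡z w)

sumℤ≡sum : ∀ {n} (f : Fin n → ℤ) → sumℤ f ≡ sum f
sumℤ≡sum {zero}  f = refl
sumℤ≡sum {suc n} f = cong (_+_ (f zero)) (sumℤ≡sum (f ∘ suc))

sum-zero : ∀ {n} {f : Fin n → ℤ} → (∀ i → f i ≡ + 0) → sum f ≡ + 0
sum-zero {n} f≗0 = trans (sum-cong-≗ f≗0) (sum-replicate-zero n)

sum-*ˡ : ∀ {n} a (f : Fin n → ℤ) → ∑[ i < n ] (a * f i) ≡ a * sum f
sum-*ˡ a f = sym (*-distribˡ-sum a f)

sum-*ʳ : ∀ {n} a (f : Fin n → ℤ) → ∑[ i < n ] (f i * a) ≡ sum f * a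
sum-*ʳ a f = trans (sum-cong-≗ (λ i → ℤP.*-comm (f i) a)) (trans (sum-*ˡ a f) (ℤP.*-comm a (sum f)))

sum-neg : ∀ {n} (f : Fin n → ℤ) → ∑[ i < n ] (- f i) ≡ - sum f
sum-neg f = trans (sum-cong-≗ (λ i → sym (ℤP.-1*i≡-i (f i))))
                  (trans (sum-*ˡ (- + 1) f) (ℤP.-1*i≡-i (sum f)))

sum-const : ∀ n a → ∑[ i < n ] a ≡ a * + n
sum-const zero    a = sym (ℤP.*-zeroʳ a)
sum-const (suc n) a = begin
  a + ∑[ i < n ] a        ≡⟨ cong₂ _+_ (sym (ℤP.*-identityʳ a)) (sum-const n a) ⟩
  a * + 1 + a * + n       ≡⟨ ℤP.*-distribˡ-+ a (+ 1) (+ n) ⟨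
  a * + suc n             ∎
  where open ≡-Reasoning

sum-↑ : ∀ {n m} (f : Fin (n ℕ.+ m) → ℤ) →
        sum f ≡ ∑[ i < n ] f (i ↑ˡ m) + ∑[ j < m ] f (n ↑ʳ j)
sum-↑ {zero}      f = sym (ℤP.+-identityˡ _)
sum-↑ {suc n} {m} f =
  trans (cong (_+_ (f zero)) (sum-↑ {n} {m} (f ∘ suc))) (sym (ℤP.+-assoc (f zero) _ _))

sum-combine : ∀ {m n} (f : Fin (m ℕ.* n) → ℤ) →
              sum f ≡ ∑[ a < m ] ∑[ s < n ] f (combine a s)
sum-combine {zero}      f = refl
sum-combine {suc m} {n} f =
  trans (sum-↑ {n} {m ℕ.* n} f) (cong (_+_ (∑[ s < n ] f (s ↑ˡ (m ℕ.* n)))) (sum-combine {m} {n} (f ∘ (n ↑ʳ_))))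

sum-single : ∀ {n} {f : Fin n → ℤ} d → (∀ j → j ≢ d → f j ≡ + 0) → sum f ≡ f d
sum-single {suc n} {f} d off = begin
  sum f                          ≡⟨ sum-remove f ⟩
  f d + sum (f ∘ punchIn d)      ≡⟨ cong (_+_ (f d)) (sum-zero (λ j → off (punchIn d j) (punchInᵢ≢i d j))) ⟩
  f d + + 0                      ≡⟨ ℤP.+-identityʳ (f d) ⟩
  f d                            ∎
  where open ≡-Reasoning

sum-pair : ∀ {n} {f : Fin n → ℤ} c d → c ≢ d → (∀ j → j ≢ c → j ≢ d → f j ≡ + 0) →
           sum f ≡ f c + f d
sum-pair {suc n} {f} c d c≢d off = begin
  sum f                          ≡⟨ sum-remove f ⟩
  f c + sum (f ∘ punchIn c)      ≡⟨ cong (_+_ (f c)) (sum-single d′ off′) ⟩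
  f c + f (punchIn c d′)         ≡⟨ cong (λ j → f c + f j) (punchIn-punchOut c≢d) ⟩
  f c + f d                      ∎
  where
  open ≡-Reasoning
  d′ = punchOut c≢d
  off′ : ∀ j → j ≢ d′ → f (punchIn c j) ≡ + 0
  off′ j j≢d′ = off (punchIn c j) (punchInᵢ≢i c j)
                  (λ e → j≢d′ (punchIn-injective c j d′ (trans e (sym (punchIn-punchOut c≢d)))))

I-diag : ∀ {n} (i : Fin n) → I n i i ≡ + 1
I-diag i with i Fin.≟ i
... | yes _  = refl
... | no i≢i = ⊥-elim (i≢i refl)

I-offDiag : ∀ {n} {i j : Fin n} → i ≢ j → I n i j ≡ + 0
I-offDiag {i = i} {j} i≢j with i Fin.≟ j
... | yes i≡j = ⊥-elim (i≢j i≡j)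
... | no _    = refl

I-sym : ∀ {n} (i j : Fin n) → I n i j ≡ I n j i
I-sym i j with i Fin.≟ j | j Fin.≟ i
... | yes _   | yes _   = refl
... | no _    | no _    = refl
... | yes i≡j | no j≢i  = ⊥-elim (j≢i (sym i≡j))
... | no i≢j  | yes j≡i = ⊥-elim (i≢j (sym j≡i))

sum-Iˡ : ∀ {n} i (f : Fin n → ℤ) → ∑[ j < n ] (I n i j * f j) ≡ f i
sum-Iˡ {n} i f =
  trans (sum-single i (λ j j≢i → trans (cong (_* f j) (I-offDiag (j≢i ∘ sym))) (ℤP.*-zeroˡ (f j))))
        (trans (cong (_* f i) (I-diag i)) (ℤP.*-identityˡ (f i)))

sum-Iʳ : ∀ {n} j (f : Fin n → ℤ) → ∑[ i < n ] (f i * I n i j) ≡ f j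
sum-Iʳ {n} j f =
  trans (sum-cong-≗ (λ i → trans (ℤP.*-comm (f i) (I n i j)) (cong (_* f i) (I-sym i j)))) (sum-Iˡ j f)

infix 4 _≐_
_≐_ : ∀ {n} → Mat n → Mat n → Set
M ≐ N = ∀ i j → M i j ≡ N i j

≐-refl : ∀ {n} {M : Mat n} → M ≐ M
≐-refl i j = refl

≐-trans : ∀ {n} {L M N : Mat n} → L ≐ M → M ≐ N → L ≐ N
≐-trans L≐M M≐N i j = trans (L≐M i j) (M≐N i j)

≐-sym : ∀ {n} {M N : Mat n} → M ≐ N → N ≐ M
≐-sym M≐N i j = sym (M≐N i j)

-- Determinants

minor : ∀ {n} → Mat (suc n) → Fin (suc n) → Mat n
minor M j r c = M (suc r) (punchIn j c)

-- The same first-row Laplace expansion as Defs.det, so that evaluating charPoly yields detℤ.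
detℤ : (n : ℕ) → Mat n → ℤ
detℤ zero    M = + 1
detℤ (suc n) M = ∑[ j < suc n ] (sign j * (M zero j * detℤ n (minor M j)))

detℤ-cong : ∀ n {M N : Mat n} → M ≐ N → detℤ n M ≡ detℤ n N
detℤ-cong zero    M≐N = refl
detℤ-cong (suc n) M≐N = sum-cong-≗ λ j →
  cong₂ (λ a d → sign j * (a * d)) (M≐N zero j) (detℤ-cong n (λ r c → M≐N (suc r) (punchIn j c)))

AgreeOff : ∀ {n} → Fin n → Mat n → Mat n → Set
AgreeOff c M N = ∀ i j → j ≢ c → M i j ≡ N i j

minor-AgreeOff-self : ∀ {n} {M N : Mat (suc n)} j → AgreeOff j M N → minor M j ≐ minor N j
minor-AgreeOff-self j M≈N r x = M≈N (suc r) (punchIn j x) (punchInᵢ≢i j x)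

minor-AgreeOff : ∀ {n} {M N : Mat (suc n)} {j c} (j≢c : j ≢ c) →
                 AgreeOff c M N → AgreeOff (punchOut j≢c) (minor M j) (minor N j)
minor-AgreeOff {j = j} j≢c M≈N r x x≢c′ =
  M≈N (suc r) (punchIn j x) (λ e → x≢c′ (punchIn-injective j x _ (trans e (sym (punchIn-punchOut j≢c)))))

minor-punchOut : ∀ {n} (M : Mat (suc n)) {j c} (j≢c : j ≢ c) r → minor M j r (punchOut j≢c) ≡ M (suc r) c
minor-punchOut M j≢c r = cong (M (suc r)) (punchIn-punchOut j≢c)

detℤ-addCol : ∀ n {M M₁ M₂ : Mat n} c → AgreeOff c M M₁ → AgreeOff c M M₂ →
              (∀ i → M i c ≡ M₁ i c + M₂ i c) → detℤ n M ≡ detℤ n M₁ + detℤ n M₂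
detℤ-addCol (suc n) {M} {M₁} {M₂} c M≈M₁ M≈M₂ Mc = trans (sum-cong-≗ expand) (∑-distrib-+ (term M₁) (term M₂))
  where
  open ≡-Reasoning
  term : Mat (suc n) → Fin (suc n) → ℤ
  term N j = sign j * (N zero j * detℤ n (minor N j))
  expand : ∀ j → term M j ≡ term M₁ j + term M₂ j
  expand j with j Fin.≟ c
  ... | yes refl = begin
    sign j * (M zero j * d)
      ≡⟨ cong (λ a → sign j * (a * d)) (Mc zero) ⟩
    sign j * ((M₁ zero j + M₂ zero j) * d)
      ≡⟨ solve 4 (λ s a b d → s :* ((a :+ b) :* d) := s :* (a :* d) :+ s :* (b :* d)) refl (sign j) (M₁ zero j) (M₂ zero j) d ⟩
    sign j * (M₁ zero j * d) + sign j * (M₂ zero j * d)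
      ≡⟨ cong₂ (λ d₁ d₂ → sign j * (M₁ zero j * d₁) + sign j * (M₂ zero j * d₂))
               (detℤ-cong n (minor-AgreeOff-self j M≈M₁)) (detℤ-cong n (minor-AgreeOff-self j M≈M₂)) ⟩
    term M₁ j + term M₂ j ∎
    where d = detℤ n (minor M j)
  ... | no j≢c = begin
    sign j * (M zero j * detℤ n (minor M j))
      ≡⟨ cong (λ d → sign j * (M zero j * d)) minor-splits ⟩
    sign j * (M zero j * (d₁ + d₂))
      ≡⟨ solve 4 (λ s m a b → s :* (m :* (a :+ b)) := s :* (m :* a) :+ s :* (m :* b)) refl (sign j) (M zero j) d₁ d₂ ⟩
    sign j * (M zero j * d₁) + sign j * (M zero j * d₂)
      ≡⟨ cong₂ (λ a₁ a₂ → sign j * (a₁ * d₁) + sign j * (a₂ * d₂)) (M≈M₁ zero j j≢c) (M≈M₂ zero j j≢c) ⟩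
    term M₁ j + term M₂ j ∎
    where
    d₁ = detℤ n (minor M₁ j)
    d₂ = detℤ n (minor M₂ j)
    minor-splits : detℤ n (minor M j) ≡ d₁ + d₂
    minor-splits = detℤ-addCol n (punchOut j≢c) (minor-AgreeOff j≢c M≈M₁) (minor-AgreeOff j≢c M≈M₂)
      (λ r → subst (λ x → M (suc r) x ≡ M₁ (suc r) x + M₂ (suc r) x) (sym (punchIn-punchOut j≢c)) (Mc (suc r)))

detℤ-scaleCol : ∀ n {M N : Mat n} a c → AgreeOff c M N → (∀ i → M i c ≡ a * N i c) →
                detℤ n M ≡ a * detℤ n N
detℤ-scaleCol (suc n) {M} {N} a c M≈N Mc = trans (sum-cong-≗ expand) (sum-*ˡ a (term N))
  where
  term : Mat (suc n) → Fin (suc n) → ℤ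
  term L j = sign j * (L zero j * detℤ n (minor L j))
  expand : ∀ j → term M j ≡ a * term N j
  expand j with j Fin.≟ c
  ... | yes refl =
    trans (cong₂ (λ m d → sign j * (m * d)) (Mc zero) (detℤ-cong n (minor-AgreeOff-self j M≈N)))
          (solve 4 (λ s a m d → s :* ((a :* m) :* d) := a :* (s :* (m :* d))) refl
                 (sign j) a (N zero j) (detℤ n (minor N j)))
  ... | no j≢c =
    trans (cong₂ (λ m d → sign j * (m * d)) (M≈N zero j j≢c) minor-scales)
          (solve 4 (λ s m a d → s :* (m :* (a :* d)) := a :* (s :* (m :* d))) refl
                 (sign j) (N zero j) a (detℤ n (minor N j)))
    where
    minor-scales : detℤ n (minor M j) ≡ a * detℤ n (minor N j)
    minor-scales = detℤ-scaleCol n a (punchOut j≢c) (minor-AgreeOff j≢c M≈N)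
      (λ r → subst (λ x → M (suc r) x ≡ a * N (suc r) x) (sym (punchIn-punchOut j≢c)) (Mc (suc r)))

setCol : ∀ {n} → Mat n → Fin n → (Fin n → ℤ) → Mat n
setCol M c v i = updateAt (M i) c (λ _ → v i)

module _ {n} (M : Mat n) (c : Fin n) where

  setCol-at : ∀ v i → setCol M c v i c ≡ v i
  setCol-at v i = updateAt-updates c (M i)

  setCol-AgreeOff : ∀ v → AgreeOff c (setCol M c v) M
  setCol-AgreeOff v i j j≢c = updateAt-minimal j c (M i) j≢c

  setCol-col : ∀ {v} → (∀ i → M i c ≡ v i) → M ≐ setCol M c v
  setCol-col {v} Mc≗v i j with j Fin.≟ c
  ... | yes refl = trans (Mc≗v i) (sym (setCol-at v i))
  ... | no j≢c   = sym (setCol-AgreeOff v i j j≢c)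

setCol-setCol : ∀ {n} (M : Mat n) c v w → setCol (setCol M c v) c w ≐ setCol M c w
setCol-setCol M c v w i j with j Fin.≟ c
... | yes refl = trans (setCol-at (setCol M c v) c w i) (sym (setCol-at M c w i))
... | no j≢c   = trans (setCol-AgreeOff (setCol M c v) c w i j j≢c)
                       (trans (setCol-AgreeOff M c v i j j≢c) (sym (setCol-AgreeOff M c w i j j≢c)))

setCol-comm : ∀ {n} (M : Mat n) {c d} → c ≢ d → ∀ u v →
              setCol (setCol M d v) c u ≐ setCol (setCol M c u) d v
setCol-comm M {c} {d} c≢d u v i j = by-cases (j Fin.≟ c) (j Fin.≟ d)
  where
  by-cases : Dec (j ≡ c) → Dec (j ≡ d) → setCol (setCol M d v) c u i j ≡ setCol (setCol M c u) d v i j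
  by-cases (yes refl) _ =
    trans (setCol-at (setCol M d v) j u i)
          (sym (trans (setCol-AgreeOff (setCol M j u) d v i j c≢d) (setCol-at M j u i)))
  by-cases (no j≢c) (yes refl) =
    trans (trans (setCol-AgreeOff (setCol M j v) c u i j j≢c) (setCol-at M j v i))
          (sym (setCol-at (setCol M c u) j v i))
  by-cases (no j≢c) (no j≢d) =
    trans (trans (setCol-AgreeOff (setCol M d v) c u i j j≢c) (setCol-AgreeOff M d v i j j≢d))
          (sym (trans (setCol-AgreeOff (setCol M c u) d v i j j≢d) (setCol-AgreeOff M c u i j j≢c)))

swapCols : ∀ {n} → Mat n → Fin n → Fin n → Mat n
swapCols M c d = setCol (setCol M d (λ i → M i c)) c (λ i → M i d)

record IsColumnMultilinear (n : ℕ) (F : Mat n → ℤ) : Set where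
  field
    F-cong     : ∀ {M N} → M ≐ N → F M ≡ F N
    F-addCol   : ∀ {M M₁ M₂} c → AgreeOff c M M₁ → AgreeOff c M M₂ →
                 (∀ i → M i c ≡ M₁ i c + M₂ i c) → F M ≡ F M₁ + F M₂
    F-scaleCol : ∀ {M N} a c → AgreeOff c M N → (∀ i → M i c ≡ a * N i c) → F M ≡ a * F N

Alternating : (n : ℕ) → (Mat n → ℤ) → Set
Alternating n F = ∀ N {c d} → c ≢ d → (∀ i → N i c ≡ N i d) → F N ≡ + 0

module ColumnMultilinear {n} {F : Mat n → ℤ} (F-multilinear : IsColumnMultilinear n F) where

  open IsColumnMultilinear F-multilinear

  F-zeroCol : ∀ {M} c → (∀ i → M i c ≡ + 0) → F M ≡ + 0
  F-zeroCol {M} c Mc≡0 =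
    trans (F-scaleCol (+ 0) c (λ _ _ _ → refl) (λ i → trans (Mc≡0 i) (sym (ℤP.*-zeroˡ (M i c)))))
          (ℤP.*-zeroˡ (F M))

  private
    agree : ∀ {M : Mat n} {c u v} → AgreeOff c (setCol M c u) (setCol M c v)
    agree {M} {c} {u} {v} i j j≢c = trans (setCol-AgreeOff M c u i j j≢c) (sym (setCol-AgreeOff M c v i j j≢c))

  F-setCol-+ : ∀ M c u v → F (setCol M c (λ i → u i + v i)) ≡ F (setCol M c u) + F (setCol M c v)
  F-setCol-+ M c u v = F-addCol c agree agree
    (λ i → trans (setCol-at M c (λ i → u i + v i) i) (sym (cong₂ _+_ (setCol-at M c u i) (setCol-at M c v i))))

  F-setCol-* : ∀ M c a v → F (setCol M c (λ i → a * v i)) ≡ a * F (setCol M c v)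
  F-setCol-* M c a v = F-scaleCol a c agree
    (λ i → trans (setCol-at M c (λ i → a * v i) i) (cong (a *_) (sym (setCol-at M c v i))))

  F-sumCol : ∀ {m} M c (a : Fin m → ℤ) (v : Fin m → Fin n → ℤ) →
             (∀ i → M i c ≡ ∑[ t < m ] (a t * v t i)) →
             F M ≡ ∑[ t < m ] (a t * F (setCol M c (v t)))
  F-sumCol {zero}  M c a v Mc = F-zeroCol c Mc
  F-sumCol {suc m} M c a v Mc = begin
    F M                                                       ≡⟨ F-cong (setCol-col M c Mc) ⟩
    F (setCol M c (λ i → a zero * v zero i + rest i))         ≡⟨ F-setCol-+ M c _ rest ⟩
    F (setCol M c (λ i → a zero * v zero i)) + F M′
                                                              ≡⟨ cong₂ _+_ (F-setCol-* M c (a zero) (v zero)) rest-expands ⟩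
    a zero * F (setCol M c (v zero))
      + ∑[ t < m ] (a (suc t) * F (setCol M c (v (suc t))))  ∎
    where
    open ≡-Reasoning
    rest : Fin n → ℤ
    rest i = ∑[ t < m ] (a (suc t) * v (suc t) i)
    M′ : Mat n
    M′ = setCol M c rest
    rest-expands : F M′ ≡ ∑[ t < m ] (a (suc t) * F (setCol M c (v (suc t))))
    rest-expands = trans (F-sumCol M′ c (a ∘ suc) (v ∘ suc) (setCol-at M c rest))
                         (sum-cong-≗ (λ t → cong (a (suc t) *_) (F-cong (setCol-setCol M c rest (v (suc t))))))

  -- Expand F at the matrix whose columns c and d both equal M·c + M·d.
  F-swapCols : ∀ {c d} → c ≢ d → (∀ N → (∀ i → N i c ≡ N i d) → F N ≡ + 0) →
               ∀ M → F M + F (swapCols M c d) ≡ + 0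
  F-swapCols {c} {d} c≢d alternating M = begin
    F M + F (swapCols M c d)                                  ≡⟨ cong (_+ F (P v u)) (F-cong (λ i j → sym (P-u-v i j))) ⟩
    F (P u v) + F (P v u)
      ≡⟨ cong₂ _+_ (sym (ℤP.+-identityˡ (F (P u v)))) (sym (ℤP.+-identityʳ (F (P v u)))) ⟩
    (+ 0 + F (P u v)) + (F (P v u) + + 0)
      ≡⟨ cong₂ (λ p q → (p + F (P u v)) + (F (P v u) + q)) (sym (P-diag u)) (sym (P-diag v)) ⟩
    (F (P u u) + F (P u v)) + (F (P v u) + F (P v v))         ≡⟨ cong₂ _+_ (P-+ʳ u) (P-+ʳ v) ⟨
    F (P u w) + F (P v w)                                     ≡⟨ F-setCol-+ (setCol M d w) c u v ⟨
    F (P w w)                                                 ≡⟨ P-diag w ⟩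
    + 0                                                       ∎
    where
    open ≡-Reasoning
    u v w : Fin n → ℤ
    u i = M i c
    v i = M i d
    w i = u i + v i
    P : (Fin n → ℤ) → (Fin n → ℤ) → Mat n
    P x y = setCol (setCol M d y) c x
    P-d : ∀ x y i → P x y i d ≡ y i
    P-d x y i = trans (setCol-AgreeOff (setCol M d y) c x i d (c≢d ∘ sym)) (setCol-at M d y i)
    P-diag : ∀ x → F (P x x) ≡ + 0
    P-diag x = alternating (P x x) (λ i → trans (setCol-at (setCol M d x) c x i) (sym (P-d x x i)))
    P-+ʳ : ∀ x → F (P x w) ≡ F (P x u) + F (P x v)
    P-+ʳ x = trans (F-cong (setCol-comm M c≢d x w))
               (trans (F-setCol-+ (setCol M c x) d u v)
                 (sym (cong₂ _+_ (F-cong (setCol-comm M c≢d x u)) (F-cong (setCol-comm M c≢d x v)))))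
    P-u-v : P u v ≐ M
    P-u-v i j = sym (trans (setCol-col M d {v} (λ _ → refl) i j)
                           (setCol-col (setCol M d v) c (λ i → setCol-AgreeOff M d v i c c≢d) i j))

detℤ-multilinear : ∀ n → IsColumnMultilinear n (detℤ n)
detℤ-multilinear n = record
  { F-cong = detℤ-cong n ; F-addCol = detℤ-addCol n ; F-scaleCol = detℤ-scaleCol n }

module Detℤ (n : ℕ) = ColumnMultilinear (detℤ-multilinear n)

data Adjacent : ∀ {n} → Fin n → Fin n → Set where
  adjacent-zero : ∀ {n} → Adjacent {suc (suc n)} zero (suc zero)
  adjacent-suc  : ∀ {n} {c d : Fin n} → Adjacent c d → Adjacent (suc c) (suc d)

Adjacent⇒≢ : ∀ {n} {c d : Fin n} → Adjacent c d → c ≢ d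
Adjacent⇒≢ adjacent-zero    ()
Adjacent⇒≢ (adjacent-suc a) e = Adjacent⇒≢ a (suc-injective e)

Adjacent-sign : ∀ {n} {c d : Fin n} → Adjacent c d → sign d ≡ - sign c
Adjacent-sign adjacent-zero    = refl
Adjacent-sign (adjacent-suc a) = cong -_ (Adjacent-sign a)

Adjacent-inject₁ : ∀ {n} (d : Fin n) → Adjacent (inject₁ d) (suc d)
Adjacent-inject₁ zero    = adjacent-zero
Adjacent-inject₁ (suc d) = adjacent-suc (Adjacent-inject₁ d)

Adjacent-punchIn : ∀ {n} {c d : Fin (suc n)} → Adjacent c d → ∀ x →
                   punchIn c x ≡ punchIn d x ⊎ (punchIn c x ≡ d × punchIn d x ≡ c)
Adjacent-punchIn adjacent-zero    zero    = inj₂ (refl , refl)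
Adjacent-punchIn adjacent-zero    (suc x) = inj₁ refl
Adjacent-punchIn (adjacent-suc a) zero    = inj₁ refl
Adjacent-punchIn (adjacent-suc a) (suc x) with Adjacent-punchIn a x
... | inj₁ e          = inj₁ (cong suc e)
... | inj₂ (e₁ , e₂)  = inj₂ (cong suc e₁ , cong suc e₂)

Adjacent-punchOut : ∀ {n} {c d j : Fin (suc n)} → Adjacent c d → (j≢c : j ≢ c) (j≢d : j ≢ d) →
                    Adjacent (punchOut j≢c) (punchOut j≢d)
Adjacent-punchOut {j = zero}                adjacent-zero j≢c j≢d = ⊥-elim (j≢c refl)
Adjacent-punchOut {j = suc zero}            adjacent-zero j≢c j≢d = ⊥-elim (j≢d refl)
Adjacent-punchOut {j = suc (suc zero)}      adjacent-zero j≢c j≢d = adjacent-zero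
Adjacent-punchOut {j = suc (suc (suc _))}   adjacent-zero j≢c j≢d = adjacent-zero
Adjacent-punchOut {j = zero}                (adjacent-suc a) j≢c j≢d = a
Adjacent-punchOut {suc n} {j = suc j}       (adjacent-suc a) j≢c j≢d =
  adjacent-suc (Adjacent-punchOut a (j≢c ∘ cong suc) (j≢d ∘ cong suc))

detℤ-adjacentCols : ∀ n (M : Mat n) {c d} → Adjacent c d → (∀ i → M i c ≡ M i d) → detℤ n M ≡ + 0
detℤ-adjacentCols (suc n) M {c} {d} a Mc≡Md = begin
  detℤ (suc n) M
    ≡⟨ sum-pair c d (Adjacent⇒≢ a) other-terms ⟩
  sign c * (M zero c * detℤ n (minor M c)) + sign d * (M zero d * detℤ n (minor M d))
    ≡⟨ cong₂ (λ s x → sign c * (M zero c * D) + s * x) (Adjacent-sign a) (cong₂ _*_ (sym (Mc≡Md zero)) D-d) ⟩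
  sign c * (M zero c * D) + - sign c * (M zero c * D)
    ≡⟨ cong (_+_ (sign c * (M zero c * D))) (ℤP.neg-distribˡ-* (sign c) (M zero c * D)) ⟨
  sign c * (M zero c * D) + - (sign c * (M zero c * D))
    ≡⟨ ℤP.+-inverseʳ (sign c * (M zero c * D)) ⟩
  + 0 ∎
  where
  open ≡-Reasoning
  D : ℤ
  D = detℤ n (minor M c)
  same-minor : minor M d ≐ minor M c
  same-minor r x with Adjacent-punchIn a x
  ... | inj₁ e          = cong (M (suc r)) (sym e)
  ... | inj₂ (e₁ , e₂)  = trans (cong (M (suc r)) e₂) (trans (Mc≡Md (suc r)) (cong (M (suc r)) (sym e₁)))
  D-d : detℤ n (minor M d) ≡ D
  D-d = detℤ-cong n same-minor
  other-terms : ∀ j → j ≢ c → j ≢ d → sign j * (M zero j * detℤ n (minor M j)) ≡ + 0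
  other-terms j j≢c j≢d =
    trans (cong (λ x → sign j * (M zero j * x))
                (detℤ-adjacentCols n (minor M j) (Adjacent-punchOut a j≢c j≢d)
                  (λ r → trans (minor-punchOut M j≢c r) (trans (Mc≡Md (suc r)) (sym (minor-punchOut M j≢d r))))))
          (trans (cong (sign j *_) (ℤP.*-zeroʳ (M zero j))) (ℤP.*-zeroʳ (sign j)))

toℕ-Adjacent : ∀ {n} {c d : Fin n} → toℕ d ≡ suc (toℕ c) → Adjacent c d
toℕ-Adjacent {c = zero}  {suc zero}    _ = adjacent-zero
toℕ-Adjacent {c = suc c} {suc d}       e = adjacent-suc (toℕ-Adjacent (ℕP.suc-injective e))
toℕ-Adjacent {c = zero}  {zero}        ()
toℕ-Adjacent {c = zero}  {suc (suc d)} ()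
toℕ-Adjacent {c = suc c} {zero}        ()

-- Column d is moved next to column c by adjacent swaps, each of which only flips the sign.
detℤ-equalCols-at-distance : ∀ g n (M : Mat n) {c d} → suc (toℕ c) ℕ.+ g ≡ toℕ d →
                             (∀ i → M i c ≡ M i d) → detℤ n M ≡ + 0
detℤ-equalCols-at-distance zero n M {c} e Mc≡Md =
  detℤ-adjacentCols n M (toℕ-Adjacent (sym (trans (sym (ℕP.+-identityʳ (suc (toℕ c)))) e))) Mc≡Md
detℤ-equalCols-at-distance (suc g) (suc n) M {d = zero} () _
detℤ-equalCols-at-distance (suc g) (suc n) M {c} {suc d} e Mc≡Md =
  x+y≡0∧y≡0⇒x≡0 (Detℤ.F-swapCols (suc n) (Adjacent⇒≢ adj) (λ N → detℤ-adjacentCols (suc n) N adj) M)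
                (detℤ-equalCols-at-distance g (suc n) M′ e′ M′c≡M′d′)
  where
  d′ = inject₁ d
  adj = Adjacent-inject₁ d
  M′ : Mat (suc n)
  M′ = swapCols M d′ (suc d)
  e′ : suc (toℕ c) ℕ.+ g ≡ toℕ d′
  e′ = trans (ℕP.suc-injective (trans (sym (ℕP.+-suc (suc (toℕ c)) g)) e)) (sym (toℕ-inject₁ d))
  c≢d′ : c ≢ d′
  c≢d′ c≡d′ = ℕP.m≢1+m+n (toℕ c) (trans (cong toℕ c≡d′) (sym e′))
  c≢sd : c ≢ suc d
  c≢sd c≡sd = ℕP.m≢1+m+n (toℕ c) (trans (cong toℕ c≡sd) (sym e))
  M′c≡M′d′ : ∀ i → M′ i c ≡ M′ i d′
  M′c≡M′d′ i = trans (setCol-AgreeOff (setCol M (suc d) col-d′) d′ col-sd i c c≢d′)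
                 (trans (setCol-AgreeOff M (suc d) col-d′ i c c≢sd)
                   (trans (Mc≡Md i) (sym (setCol-at (setCol M (suc d) col-d′) d′ col-sd i))))
    where
    col-d′ col-sd : Fin (suc n) → ℤ
    col-d′ i = M i d′
    col-sd i = M i (suc d)

detℤ-equalCols : ∀ n (M : Mat n) {c d} → c ≢ d → (∀ i → M i c ≡ M i d) → detℤ n M ≡ + 0
detℤ-equalCols n M {c} {d} c≢d Mc≡Md with ℕP.<-cmp (toℕ c) (toℕ d)
... | tri< c<d _ _ = detℤ-equalCols-at-distance _ n M (proj₂ (ℕP.m≤n⇒∃[o]m+o≡n c<d)) Mc≡Md
... | tri≈ _ c≡d _ = ⊥-elim (c≢d (toℕ-injective c≡d))
... | tri> _ _ d<c = detℤ-equalCols-at-distance _ n M (proj₂ (ℕP.m≤n⇒∃[o]m+o≡n d<c)) (sym ∘ Mc≡Md)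

transpose-at₁ : ∀ {n} (c d : Fin n) → transpose c d c ≡ d
transpose-at₁ c d rewrite dec-true (c Fin.≟ c) refl = refl

transpose-at₂ : ∀ {n} {c d : Fin n} → c ≢ d → transpose c d d ≡ c
transpose-at₂ {c = c} {d} c≢d rewrite dec-false (d Fin.≟ c) (c≢d ∘ sym) | dec-true (d Fin.≟ d) refl = refl

transpose-other : ∀ {n} {c d k : Fin n} → k ≢ c → k ≢ d → transpose c d k ≡ k
transpose-other {c = c} {d} {k} k≢c k≢d rewrite dec-false (k Fin.≟ c) k≢c | dec-false (k Fin.≟ d) k≢d = refl

swapCols-transpose : ∀ {n} (M : Mat n) {c d} → c ≢ d → swapCols M c d ≐ λ i j → M i (transpose c d j)
swapCols-transpose {n} M {c} {d} c≢d i j = by-cases (j Fin.≟ c) (j Fin.≟ d)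
  where
  u v : Fin n → ℤ
  u i = M i c
  v i = M i d
  by-cases : Dec (j ≡ c) → Dec (j ≡ d) → swapCols M c d i j ≡ M i (transpose c d j)
  by-cases (yes refl) _ =
    trans (setCol-at (setCol M d u) j v i) (cong (M i) (sym (transpose-at₁ j d)))
  by-cases (no j≢c) (yes refl) =
    trans (setCol-AgreeOff (setCol M j u) c v i j j≢c)
          (trans (setCol-at M j u i) (cong (M i) (sym (transpose-at₂ c≢d))))
  by-cases (no j≢c) (no j≢d) =
    trans (setCol-AgreeOff (setCol M d u) c v i j j≢c)
          (trans (setCol-AgreeOff M d u i j j≢d) (cong (M i) (sym (transpose-other j≢c j≢d))))

missing⇒collision : ∀ {n} (f : Fin n → Fin n) k → (∀ c → f c ≢ k) → ∃₂ λ a b → a ≢ b × f a ≡ f b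
missing⇒collision {suc n} f k misses
  with pigeonhole (ℕP.n<1+n n) (λ i → punchOut (misses i ∘ sym))
... | a , b , a<b , e = a , b , <⇒≢ a<b , punchOut-injective (misses a ∘ sym) (misses b ∘ sym) e

unitCols : ∀ {n} → (Fin n → Fin n) → Mat n
unitCols {n} f i j = I n i (f j)

-- Expanding every column in unit vectors reduces F to matrices with unit-vector columns; such a
-- matrix has two equal columns unless column swaps turn it into I.
module AlternatingForm {n} {F : Mat n → ℤ} (F-multilinear : IsColumnMultilinear n F)
  (F-alternating : Alternating n F) (F-I≡0 : F (I n) ≡ + 0) where

  open IsColumnMultilinear F-multilinear
  open ColumnMultilinear F-multilinear

  FixedFrom : ℕ → (Fin n → Fin n) → Set
  FixedFrom k f = ∀ j → k ≤ toℕ j → f j ≡ j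

  private
    at-or-above : ∀ {k j} (k<n : k ℕ.< n) → k ≤ toℕ j → j ≡ fromℕ< k<n ⊎ suc k ≤ toℕ j
    at-or-above k<n k≤j with ℕP.m≤n⇒m<n∨m≡n k≤j
    ... | inj₁ k<j = inj₂ k<j
    ... | inj₂ k≡j = inj₁ (toℕ-injective (trans (sym k≡j) (sym (toℕ-fromℕ< k<n))))

    above⇒≢ : ∀ {k j} (k<n : k ℕ.< n) → suc k ≤ toℕ j → j ≢ fromℕ< k<n
    above⇒≢ k<n k<j refl = ℕP.<-irrefl (sym (toℕ-fromℕ< k<n)) k<j

    beyond : ∀ {k j} → ¬ k ℕ.< n → ¬ k ≤ toℕ j
    beyond k≮n k≤j = k≮n (ℕP.≤-<-trans k≤j (toℕ<n _))

  FixedFrom-fixed : ∀ {k f} (k<n : k ℕ.< n) → FixedFrom (suc k) f →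
                    f (fromℕ< k<n) ≡ fromℕ< k<n → FixedFrom k f
  FixedFrom-fixed k<n fixed fk≡k j k≤j with at-or-above k<n k≤j
  ... | inj₁ refl = fk≡k
  ... | inj₂ k<j  = fixed j k<j

  FixedFrom-transpose : ∀ {k f c} (k<n : k ℕ.< n) → FixedFrom (suc k) f →
                        f c ≡ fromℕ< k<n → FixedFrom k (f ∘ transpose (fromℕ< k<n) c)
  FixedFrom-transpose {f = f} {c} k<n fixed fc≡k j k≤j with at-or-above k<n k≤j
  ... | inj₁ refl = trans (cong f (transpose-at₁ j c)) fc≡k
  ... | inj₂ k<j  = trans (cong f (transpose-other (above⇒≢ k<n k<j) j≢c)) (fixed j k<j)
    where
    j≢c : j ≢ c
    j≢c refl = above⇒≢ k<n k<j (trans (sym (fixed j k<j)) fc≡k)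

  F-unitCols : ∀ k f → FixedFrom k f → F (unitCols f) ≡ + 0
  F-unitCols zero    f fixed = trans (F-cong (λ i j → cong (I n i) (fixed j z≤n))) F-I≡0
  F-unitCols (suc k) f fixed with k ℕ.<? n
  ... | no k≮n = F-unitCols k f (λ j k≤j → ⊥-elim (beyond k≮n k≤j))
  ... | yes k<n with f (fromℕ< k<n) Fin.≟ fromℕ< k<n | any? (λ c → f c Fin.≟ fromℕ< k<n)
  ...   | yes fk≡k | _            = F-unitCols k f (FixedFrom-fixed k<n fixed fk≡k)
  ...   | no fk≢k  | yes (c , fc≡k) =
    x+y≡0∧y≡0⇒x≡0 (F-swapCols k≢c (λ N → F-alternating N k≢c) (unitCols f))
                  (trans (F-cong (swapCols-transpose (unitCols f) k≢c))
                         (F-unitCols k (f ∘ transpose (fromℕ< k<n) c) (FixedFrom-transpose k<n fixed fc≡k)))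
    where
    k≢c : fromℕ< k<n ≢ c
    k≢c k≡c = fk≢k (trans (cong f k≡c) fc≡k)
  ...   | no _     | no misses-k with missing⇒collision f (fromℕ< k<n) (λ c fc≡k → misses-k (c , fc≡k))
  ...     | a , b , a≢b , fa≡fb = F-alternating (unitCols f) a≢b (λ i → cong (I n i) fa≡fb)

  UnitFrom : ℕ → Mat n → (Fin n → Fin n) → Set
  UnitFrom k N f = ∀ i j → k ≤ toℕ j → N i j ≡ I n i (f j)

  UnitFrom-expand : ∀ {k N f} (k<n : k ℕ.< n) → UnitFrom (suc k) N f → ∀ r →
                    UnitFrom k (setCol N (fromℕ< k<n) (λ i → I n i r)) (updateAt f (fromℕ< k<n) (λ _ → r))
  UnitFrom-expand {N = N} {f} k<n unit r i j k≤j with j Fin.≟ fromℕ< k<n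
  ... | yes refl = trans (setCol-at N j (λ i → I n i r) i) (cong (I n i) (sym (updateAt-updates j f)))
  ... | no j≢k with at-or-above k<n k≤j
  ...   | inj₁ j≡k = ⊥-elim (j≢k j≡k)
  ...   | inj₂ k<j = trans (setCol-AgreeOff N (fromℕ< k<n) (λ i → I n i r) i j j≢k)
                           (trans (unit i j k<j) (cong (I n i) (sym (updateAt-minimal j (fromℕ< k<n) f j≢k))))

  F-UnitFrom : ∀ k N f → UnitFrom k N f → F N ≡ + 0
  F-UnitFrom zero N f unit =
    trans (F-cong (λ i j → unit i j z≤n)) (F-unitCols n f (λ j n≤j → ⊥-elim (ℕP.<⇒≱ (toℕ<n j) n≤j)))
  F-UnitFrom (suc k) N f unit with k ℕ.<? n
  ... | no k≮n  = F-UnitFrom k N f (λ i j k≤j → ⊥-elim (beyond k≮n k≤j))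
  ... | yes k<n =
    trans (F-sumCol N c (λ r → N r c) (λ r i → I n i r)
                    (λ i → sym (trans (sum-cong-≗ (λ r → cong (N r c *_) (I-sym i r))) (sum-Iʳ i (λ r → N r c)))))
          (sum-zero (λ r → trans (cong (N r c *_) (F-UnitFrom k _ _ (UnitFrom-expand k<n unit r)))
                                 (ℤP.*-zeroʳ (N r c))))
    where c = fromℕ< k<n

  F≡0 : ∀ N → F N ≡ + 0
  F≡0 N = F-UnitFrom n N (λ j → j) (λ i j n≤j → ⊥-elim (ℕP.<⇒≱ (toℕ<n j) n≤j))

infixl 7 _·_
_·_ : ∀ {n} → Mat n → Mat n → Mat n
_·_ {n} M N i j = ∑[ t < n ] (M i t * N t j)

·-cong : ∀ {n} {M M′ N N′ : Mat n} → M ≐ M′ → N ≐ N′ → M · N ≐ M′ · N′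
·-cong M≐M′ N≐N′ i j = sum-cong-≗ (λ t → cong₂ _*_ (M≐M′ i t) (N≐N′ t j))

·-I : ∀ {n} (M : Mat n) → M · I n ≐ M
·-I M i j = sum-Iʳ j (M i)

I-· : ∀ {n} (M : Mat n) → I n · M ≐ M
I-· M i j = sum-Iˡ i (λ t → M t j)

I-suc : ∀ {n} (i j : Fin n) → I (suc n) (suc i) (suc j) ≡ I n i j
I-suc {n} i j = by-cases (i Fin.≟ j)
  where
  by-cases : Dec (i ≡ j) → I (suc n) (suc i) (suc j) ≡ I n i j
  by-cases (yes refl) = trans (I-diag (suc i)) (sym (I-diag i))
  by-cases (no i≢j)   = trans (I-offDiag (i≢j ∘ suc-injective)) (sym (I-offDiag i≢j))

detℤ-scalar : ∀ n a → detℤ n (λ i j → a * I n i j) ≡ a ^ n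
detℤ-scalar zero    a = refl
detℤ-scalar (suc n) a = begin
  detℤ (suc n) S                                   ≡⟨ sum-single zero off-diagonal ⟩
  + 1 * ((a * + 1) * detℤ n (minor S zero))        ≡⟨ cong (λ d → + 1 * ((a * + 1) * d)) minor-scalar ⟩
  + 1 * ((a * + 1) * a ^ n)
    ≡⟨ solve 2 (λ a p → con (+ 1) :* ((a :* con (+ 1)) :* p) := a :* p) refl a (a ^ n) ⟩
  a ^ suc n                                        ∎
  where
  open ≡-Reasoning
  S : Mat (suc n)
  S i j = a * I (suc n) i j
  minor-scalar : detℤ n (minor S zero) ≡ a ^ n
  minor-scalar = trans (detℤ-cong n (λ r c → cong (a *_) (I-suc r c))) (detℤ-scalar n a)
  off-diagonal : ∀ j → j ≢ zero → sign j * (S zero j * detℤ n (minor S j)) ≡ + 0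
  off-diagonal j j≢0 = trans (cong (λ x → sign j * (a * x * detℤ n (minor S j))) (I-offDiag (j≢0 ∘ sym)))
                             (solve 3 (λ s a d → s :* (a :* con (+ 0) :* d) := con (+ 0)) refl (sign j) a (detℤ n (minor S j)))

detℤ-I : ∀ n → detℤ n (I n) ≡ + 1
detℤ-I n = trans (detℤ-cong n (λ i j → sym (ℤP.*-identityˡ (I n i j))))
                 (trans (detℤ-scalar n (+ 1)) (ℤP.^-zeroˡ n))

module _ {n} {F : Mat n → ℤ} where

  ·-multilinearʳ : (M : Mat n) → IsColumnMultilinear n F → IsColumnMultilinear n (λ N → F (M · N))
  ·-multilinearʳ M F-ml = record { F-cong = cong′ ; F-addCol = addCol ; F-scaleCol = scaleCol }
    where
    open IsColumnMultilinear F-ml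
    M·-cong : ∀ {N N′ j} → (∀ t → N t j ≡ N′ t j) → ∀ i → (M · N) i j ≡ (M · N′) i j
    M·-cong Nj≗N′j i = sum-cong-≗ (λ t → cong (M i t *_) (Nj≗N′j t))
    cong′ : ∀ {N N′} → N ≐ N′ → F (M · N) ≡ F (M · N′)
    cong′ {N} {N′} N≐N′ = F-cong (λ i j → M·-cong {N} {N′} (λ t → N≐N′ t j) i)
    agree : ∀ {c N N′} → AgreeOff c N N′ → AgreeOff c (M · N) (M · N′)
    agree {N = N} {N′} N≈N′ i j j≢c = M·-cong {N} {N′} (λ t → N≈N′ t j j≢c) i
    addCol : ∀ {N N₁ N₂} c → AgreeOff c N N₁ → AgreeOff c N N₂ → (∀ i → N i c ≡ N₁ i c + N₂ i c) →
             F (M · N) ≡ F (M · N₁) + F (M · N₂)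
    addCol {N} {N₁} {N₂} c N≈N₁ N≈N₂ Nc = F-addCol c (agree N≈N₁) (agree N≈N₂) (λ i →
      trans (sum-cong-≗ (λ t → trans (cong (M i t *_) (Nc t)) (ℤP.*-distribˡ-+ (M i t) (N₁ t c) (N₂ t c))))
            (∑-distrib-+ (λ t → M i t * N₁ t c) (λ t → M i t * N₂ t c)))
    scaleCol : ∀ {N N′} a c → AgreeOff c N N′ → (∀ i → N i c ≡ a * N′ i c) → F (M · N) ≡ a * F (M · N′)
    scaleCol {N} {N′} a c N≈N′ Nc = F-scaleCol a c (agree N≈N′) (λ i →
      trans (sum-cong-≗ (λ t → trans (cong (M i t *_) (Nc t))
                                     (solve 3 (λ x a y → x :* (a :* y) := a :* (x :* y)) refl (M i t) a (N′ t c))))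
            (sum-*ˡ a (λ t → M i t * N′ t c)))

  ·-alternatingʳ : (M : Mat n) → Alternating n F → Alternating n (λ N → F (M · N))
  ·-alternatingʳ M F-alt N c≢d Nc≡Nd = F-alt (M · N) c≢d (λ i → sum-cong-≗ (λ t → cong (M i t *_) (Nc≡Nd t)))

  module _ {G : Mat n → ℤ} (a : ℤ) where

    difference-multilinear : IsColumnMultilinear n F → IsColumnMultilinear n G →
                             IsColumnMultilinear n (λ N → F N - a * G N)
    difference-multilinear F-ml G-ml = record { F-cong = cong′ ; F-addCol = addCol ; F-scaleCol = scaleCol }
      where
      module F = IsColumnMultilinear F-ml
      module G = IsColumnMultilinear G-ml
      cong′ : ∀ {N N′} → N ≐ N′ → F N - a * G N ≡ F N′ - a * G N′
      cong′ N≐N′ = cong₂ (λ p q → p - a * q) (F.F-cong N≐N′) (G.F-cong N≐N′)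
      addCol : ∀ {N N₁ N₂} c → AgreeOff c N N₁ → AgreeOff c N N₂ → (∀ i → N i c ≡ N₁ i c + N₂ i c) →
               F N - a * G N ≡ (F N₁ - a * G N₁) + (F N₂ - a * G N₂)
      addCol {N} {N₁} {N₂} c h₁ h₂ hc =
        trans (cong₂ (λ p q → p - a * q) (F.F-addCol c h₁ h₂ hc) (G.F-addCol c h₁ h₂ hc))
              (solve 5 (λ f₁ f₂ a g₁ g₂ → (f₁ :+ f₂) :- a :* (g₁ :+ g₂) := (f₁ :- a :* g₁) :+ (f₂ :- a :* g₂))
                     refl (F N₁) (F N₂) a (G N₁) (G N₂))
      scaleCol : ∀ {N N′} b c → AgreeOff c N N′ → (∀ i → N i c ≡ b * N′ i c) →
                 F N - a * G N ≡ b * (F N′ - a * G N′)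
      scaleCol {N} {N′} b c h hc =
        trans (cong₂ (λ p q → p - a * q) (F.F-scaleCol b c h hc) (G.F-scaleCol b c h hc))
              (solve 4 (λ b f a g → b :* f :- a :* (b :* g) := b :* (f :- a :* g)) refl b (F N′) a (G N′))

    difference-alternating : Alternating n F → Alternating n G → Alternating n (λ N → F N - a * G N)
    difference-alternating F-alt G-alt N c≢d Nc≡Nd =
      trans (cong₂ (λ p q → p - a * q) (F-alt N c≢d Nc≡Nd) (G-alt N c≢d Nc≡Nd))
            (cong (λ q → + 0 - q) (ℤP.*-zeroʳ a))

detℤ-· : ∀ n (M N : Mat n) → detℤ n (M · N) ≡ detℤ n M * detℤ n N
detℤ-· n M N = ℤP.i-j≡0⇒i≡j _ _ (Difference.F≡0 N)
  where
  at-I : detℤ n (M · I n) - detℤ n M * detℤ n (I n) ≡ + 0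
  at-I = trans (cong₂ (λ p q → p - detℤ n M * q) (detℤ-cong n (·-I M)) (detℤ-I n))
               (trans (cong (_-_ (detℤ n M)) (ℤP.*-identityʳ (detℤ n M))) (ℤP.+-inverseʳ (detℤ n M)))
  module Difference = AlternatingForm
    (difference-multilinear (detℤ n M) (·-multilinearʳ M (detℤ-multilinear n)) (detℤ-multilinear n))
    (difference-alternating (detℤ n M) (·-alternatingʳ M (detℤ-equalCols n)) (detℤ-equalCols n))
    at-I

detℤ-* : ∀ n a (M : Mat n) → detℤ n (λ i j → a * M i j) ≡ a ^ n * detℤ n M
detℤ-* n a M = begin
  detℤ n (λ i j → a * M i j)                    ≡⟨ detℤ-cong n scalar-· ⟨
  detℤ n (aI · M)                               ≡⟨ detℤ-· n aI M ⟩
  detℤ n aI * detℤ n M                          ≡⟨ cong (_* detℤ n M) (detℤ-scalar n a) ⟩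
  a ^ n * detℤ n M                              ∎
  where
  open ≡-Reasoning
  aI : Mat n
  aI i j = a * I n i j
  scalar-· : aI · M ≐ λ i j → a * M i j
  scalar-· i j = trans (sum-cong-≗ (λ t → ℤP.*-assoc a (I n i t) (M t j)))
                       (trans (sum-*ˡ a (λ t → I n i t * M t j)) (cong (a *_) (sum-Iˡ i (λ t → M t j))))

rowMinor : ∀ {n} → Mat (suc n) → Fin (suc n) → Mat n
rowMinor M i r c = M (punchIn i r) (suc c)

detℤ-unitCol₀ : ∀ n (N : Mat (suc n)) i → (∀ r → N r zero ≡ I (suc n) r i) →
                detℤ (suc n) N ≡ sign i * detℤ n (rowMinor N i)
detℤ-unitCol₀ zero    N zero    N₀ = cong (λ x → + 1 * (x * + 1) + + 0) (N₀ zero)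
detℤ-unitCol₀ (suc n) N zero    N₀ =
  trans (sum-single zero off-diagonal)
        (trans (cong (λ x → + 1 * (x * detℤ (suc n) (rowMinor N zero))) (N₀ zero))
               (cong (+ 1 *_) (ℤP.*-identityˡ (detℤ (suc n) (rowMinor N zero)))))
  where
  off-diagonal : ∀ j → j ≢ zero → sign j * (N zero j * detℤ (suc n) (minor N j)) ≡ + 0
  off-diagonal zero    0≢0 = ⊥-elim (0≢0 refl)
  off-diagonal (suc j) _   =
    trans (cong (λ d → sign (suc j) * (N zero (suc j) * d))
                (Detℤ.F-zeroCol (suc n) {minor N (suc j)} zero
                                (λ r → trans (N₀ (suc r)) (I-offDiag {i = suc r} {zero} (λ ())))))
          (trans (cong (sign (suc j) *_) (ℤP.*-zeroʳ (N zero (suc j)))) (ℤP.*-zeroʳ (sign (suc j))))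
detℤ-unitCol₀ (suc n) N (suc i) N₀ = begin
  detℤ (suc (suc n)) N                                                    ≡⟨ cong (_+ rest) first-term ⟩
  + 0 + rest                                                              ≡⟨ ℤP.+-identityˡ rest ⟩
  rest                                                                    ≡⟨ sum-cong-≗ expand ⟩
  ∑[ j < suc n ] (- sign i * (sign j * (N zero (suc j) * D j)))
    ≡⟨ sum-*ˡ (- sign i) (λ j → sign j * (N zero (suc j) * D j)) ⟩
  - sign i * detℤ (suc n) (rowMinor N (suc i))                           ∎
  where
  open ≡-Reasoning
  D : Fin (suc n) → ℤ
  D j = detℤ n (minor (rowMinor N (suc i)) j)
  rest : ℤ
  rest = ∑[ j < suc n ] (sign (suc j) * (N zero (suc j) * detℤ (suc n) (minor N (suc j))))
  first-term : sign (zero {suc n}) * (N zero zero * detℤ (suc n) (minor N zero)) ≡ + 0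
  first-term = trans (cong (λ x → + 1 * (x * detℤ (suc n) (minor N zero))) (N₀ zero))
                     (cong (+ 1 *_) (ℤP.*-zeroˡ (detℤ (suc n) (minor N zero))))
  expand : ∀ j → sign (suc j) * (N zero (suc j) * detℤ (suc n) (minor N (suc j)))
                 ≡ - sign i * (sign j * (N zero (suc j) * D j))
  expand j = trans (cong (λ d → - sign j * (N zero (suc j) * d))
                         (detℤ-unitCol₀ n (minor N (suc j)) i (λ r → trans (N₀ (suc r)) (I-suc r i))))
                   (solve 4 (λ s m t d → (:- s) :* (m :* (t :* d)) := (:- t) :* (s :* (m :* d))) refl
                          (sign j) (N zero (suc j)) (sign i) (D j))

detℤ-expandCol₀ : ∀ n (M : Mat (suc n)) →
                  detℤ (suc n) M ≡ ∑[ i < suc n ] (M i zero * (sign i * detℤ n (rowMinor M i)))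
detℤ-expandCol₀ n M =
  trans (Detℤ.F-sumCol (suc n) M zero (λ t → M t zero) e
          (λ r → sym (trans (sum-cong-≗ (λ t → cong (M t zero *_) (I-sym r t))) (sum-Iʳ r (λ t → M t zero)))))
        (sum-cong-≗ (λ t → cong (M t zero *_) (trans
          (detℤ-unitCol₀ n (setCol M zero (e t)) t (setCol-at M zero (e t)))
          (cong (sign t *_) (detℤ-cong n (λ r c → setCol-AgreeOff M zero (e t) (punchIn t r) (suc c) (λ ())))))))
  where
  e : Fin (suc n) → Fin (suc n) → ℤ
  e t r = I (suc n) r t

detℤ-transpose : ∀ n (M : Mat n) → detℤ n (λ i j → M j i) ≡ detℤ n M
detℤ-transpose zero    M = refl
detℤ-transpose (suc n) M =
  trans (sum-cong-≗ (λ j →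
           trans (cong (λ d → sign j * (M j zero * d)) (detℤ-transpose n (rowMinor M j)))
                 (solve 3 (λ s m d → s :* (m :* d) := m :* (s :* d)) refl (sign j) (M j zero) (detℤ n (rowMinor M j)))))
        (sym (detℤ-expandCol₀ n M))

sign-↑ˡ : ∀ {n} (i : Fin n) m → sign (i ↑ˡ m) ≡ sign i
sign-↑ˡ zero    m = refl
sign-↑ˡ (suc i) m = cong -_ (sign-↑ˡ i m)

punchIn-↑ˡ-↑ˡ : ∀ {n m} (i : Fin (suc n)) (b : Fin n) → punchIn (i ↑ˡ m) (b ↑ˡ m) ≡ punchIn i b ↑ˡ m
punchIn-↑ˡ-↑ˡ zero    b       = refl
punchIn-↑ˡ-↑ˡ (suc i) zero    = refl
punchIn-↑ˡ-↑ˡ (suc i) (suc b) = cong suc (punchIn-↑ˡ-↑ˡ i b)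

punchIn-↑ˡ-↑ʳ : ∀ {n m} (i : Fin (suc n)) (b : Fin m) → punchIn (i ↑ˡ m) (n ↑ʳ b) ≡ suc n ↑ʳ b
punchIn-↑ˡ-↑ʳ         zero    b = refl
punchIn-↑ˡ-↑ʳ {suc n} (suc i) b = cong suc (punchIn-↑ˡ-↑ʳ i b)

detℤ-blockLower : ∀ n m (M : Mat (n ℕ.+ m)) → (∀ i j → M (i ↑ˡ m) (n ↑ʳ j) ≡ + 0) →
  detℤ (n ℕ.+ m) M ≡ detℤ n (λ i j → M (i ↑ˡ m) (j ↑ˡ m)) * detℤ m (λ i j → M (n ↑ʳ i) (n ↑ʳ j))
detℤ-blockLower zero    m M _  = sym (ℤP.*-identityˡ _)
detℤ-blockLower (suc n) m M UR≡0 = begin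
  detℤ (suc n ℕ.+ m) M                                          ≡⟨ sum-↑ {suc n} {m} (term M) ⟩
  ∑[ i < suc n ] term M (i ↑ˡ m) + ∑[ j < m ] term M (suc n ↑ʳ j) ≡⟨ cong₂ _+_ (sum-cong-≗ left) (sum-zero right) ⟩
  ∑[ i < suc n ] (term TL i * detℤ m BR) + + 0                   ≡⟨ ℤP.+-identityʳ _ ⟩
  ∑[ i < suc n ] (term TL i * detℤ m BR)                         ≡⟨ sum-*ʳ (detℤ m BR) (term TL) ⟩
  detℤ (suc n) TL * detℤ m BR                                    ∎
  where
  open ≡-Reasoning
  term : ∀ {k} → Mat (suc k) → Fin (suc k) → ℤ
  term {k} N j = sign j * (N zero j * detℤ k (minor N j))
  TL : Mat (suc n)
  TL i j = M (i ↑ˡ m) (j ↑ˡ m)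
  BR : Mat m
  BR i j = M (suc n ↑ʳ i) (suc n ↑ʳ j)
  right : ∀ j → term M (suc n ↑ʳ j) ≡ + 0
  right j = trans (cong (λ x → sign (suc n ↑ʳ j) * (x * detℤ (n ℕ.+ m) (minor M (suc n ↑ʳ j)))) (UR≡0 zero j))
                  (solve 2 (λ s d → s :* (con (+ 0) :* d) := con (+ 0)) refl
                         (sign (suc n ↑ʳ j)) (detℤ (n ℕ.+ m) (minor M (suc n ↑ʳ j))))
  minor-splits : ∀ i → detℤ (n ℕ.+ m) (minor M (i ↑ˡ m)) ≡ detℤ n (minor TL i) * detℤ m BR
  minor-splits i =
    trans (detℤ-blockLower n m (minor M (i ↑ˡ m))
                           (λ a b → trans (cong (M (suc a ↑ˡ m)) (punchIn-↑ˡ-↑ʳ i b)) (UR≡0 (suc a) b)))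
          (cong₂ _*_ (detℤ-cong n (λ a b → cong (M (suc a ↑ˡ m)) (punchIn-↑ˡ-↑ˡ i b)))
                     (detℤ-cong m (λ a b → cong (M (suc n ↑ʳ a)) (punchIn-↑ˡ-↑ʳ i b))))
  left : ∀ i → term M (i ↑ˡ m) ≡ term TL i * detℤ m BR
  left i = trans (cong₂ (λ s d → s * (M zero (i ↑ˡ m) * d)) (sign-↑ˡ i m) (minor-splits i))
                 (solve 4 (λ s x d e → s :* (x :* (d :* e)) := s :* (x :* d) :* e) refl
                        (sign i) (TL zero i) (detℤ n (minor TL i)) (detℤ m BR))

detℤ-blockUpper : ∀ n m (M : Mat (n ℕ.+ m)) → (∀ i j → M (n ↑ʳ i) (j ↑ˡ m) ≡ + 0) →
  detℤ (n ℕ.+ m) M ≡ detℤ n (λ i j → M (i ↑ˡ m) (j ↑ˡ m)) * detℤ m (λ i j → M (n ↑ʳ i) (n ↑ʳ j))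
detℤ-blockUpper n m M LL≡0 =
  trans (sym (detℤ-transpose (n ℕ.+ m) M))
    (trans (detℤ-blockLower n m (λ i j → M j i) (λ i j → LL≡0 j i))
      (cong₂ _*_ (detℤ-transpose n (λ i j → M (i ↑ˡ m) (j ↑ˡ m)))
                 (detℤ-transpose m (λ i j → M (n ↑ʳ i) (n ↑ʳ j)))))

detℤ-cast : ∀ {n m} (e : n ≡ m) (N : Mat m) → detℤ m N ≡ detℤ n (λ s t → N (cast e s) (cast e t))
detℤ-cast refl N = detℤ-cong _ (λ s t → sym (cong₂ N (cast-is-id refl s) (cast-is-id refl t)))

detℤ-+0 : ∀ n (N : Mat (n ℕ.+ 0)) → detℤ (n ℕ.+ 0) N ≡ detℤ n (λ s t → N (s ↑ˡ 0) (t ↑ˡ 0))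
detℤ-+0 n N = trans (detℤ-cast (sym (ℕP.+-identityʳ n)) N)
                    (detℤ-cong n (λ s t → cong₂ N (cast≡↑ˡ0 s) (cast≡↑ˡ0 t)))
  where
  cast≡↑ˡ0 : ∀ s → cast (sym (ℕP.+-identityʳ n)) s ≡ s ↑ˡ 0
  cast≡↑ˡ0 s = toℕ-injective (trans (toℕ-cast _ s) (sym (toℕ-↑ˡ s 0)))

↑ˡ0-surjective : ∀ {n} (j : Fin (n ℕ.+ 0)) → j ≡ cast (ℕP.+-identityʳ n) j ↑ˡ 0
↑ˡ0-surjective {n} j = toℕ-injective (trans (sym (toℕ-cast (ℕP.+-identityʳ n) j)) (sym (toℕ-↑ˡ _ 0)))

-- Block matrices and Kronecker products

combine-induction : ∀ {m n} (P : Fin (m ℕ.* n) → Set) → (∀ (a : Fin m) (s : Fin n) → P (combine a s)) → ∀ r → P r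
combine-induction {m} {n} P h r with combine-surjective {m} {n} r
... | a , s , refl = h a s

≐-combine : ∀ {m n} {M N : Mat (m ℕ.* n)} →
            (∀ (a : Fin m) (s : Fin n) (b : Fin m) (t : Fin n) →
               M (combine a s) (combine b t) ≡ N (combine a s) (combine b t)) →
            M ≐ N
≐-combine {M = M} {N} h = combine-induction (λ r → ∀ c → M r c ≡ N r c) (λ a s → combine-induction _ (h a s))

I-combine : ∀ {m n} (a b : Fin m) (s t : Fin n) → I (m ℕ.* n) (combine a s) (combine b t) ≡ I m a b * I n s t
I-combine {m} {n} a b s t = by-cases (a Fin.≟ b) (s Fin.≟ t)
  where
  by-cases : Dec (a ≡ b) → Dec (s ≡ t) → I (m ℕ.* n) (combine a s) (combine b t) ≡ I m a b * I n s t
  by-cases (yes refl) (yes refl) = trans (I-diag (combine a s)) (sym (cong₂ _*_ (I-diag a) (I-diag s)))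
  by-cases (yes refl) (no s≢t)   = trans (I-offDiag (s≢t ∘ combine-injectiveʳ a s a t))
                                         (sym (trans (cong (I m a a *_) (I-offDiag s≢t)) (ℤP.*-zeroʳ (I m a a))))
  by-cases (no a≢b)   _          = trans (I-offDiag (a≢b ∘ combine-injectiveˡ a s b t))
                                         (sym (trans (cong (_* I n s t) (I-offDiag a≢b)) (ℤP.*-zeroˡ (I n s t))))

blocks : ∀ {m n} → (Fin m → Fin m → Mat n) → Mat (m ℕ.* n)
blocks {m} {n} X r c = X (proj₁ (remQuot {m} n r)) (proj₁ (remQuot {m} n c)) (proj₂ (remQuot {m} n r)) (proj₂ (remQuot {m} n c))

blocks-combine : ∀ {m n} (X : Fin m → Fin m → Mat n) (a : Fin m) (s : Fin n) (b : Fin m) (t : Fin n) →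
                 blocks X (combine a s) (combine b t) ≡ X a b s t
blocks-combine {m} {n} X a s b t =
  cong₂ (λ p q → X (proj₁ p) (proj₁ q) (proj₂ p) (proj₂ q)) (remQuot-combine {m} {n} a s) (remQuot-combine {m} {n} b t)

⊗≐blocks : ∀ {m n} (K : Mat m) (N : Mat n) → K ⊗ N ≐ blocks (λ a b s t → K a b * N s t)
⊗≐blocks {m} {n} K N r c with remQuot {m} n r | remQuot {m} n c
... | a , s | b , t = refl

⊗-combine : ∀ {m n} (K : Mat m) (N : Mat n) (a : Fin m) (s : Fin n) (b : Fin m) (t : Fin n) →
            (K ⊗ N) (combine a s) (combine b t) ≡ K a b * N s t
⊗-combine K N a s b t = trans (⊗≐blocks K N (combine a s) (combine b t)) (blocks-combine (λ a b s t → K a b * N s t) a s b t)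

·-combine : ∀ {m n} (M N : Mat (m ℕ.* n)) (a : Fin m) (s : Fin n) (b : Fin m) (t : Fin n) →
            (M · N) (combine a s) (combine b t)
            ≡ ∑[ a′ < m ] ∑[ s′ < n ] (M (combine a s) (combine a′ s′) * N (combine a′ s′) (combine b t))
·-combine {m} {n} M N a s b t = sum-combine {m} {n} (λ r → M (combine a s) r * N r (combine b t))

blocks-· : ∀ {m n} (X : Fin m → Fin m → Mat n) (M : Mat (m ℕ.* n)) (a : Fin m) (s : Fin n) (b : Fin m) (t : Fin n) →
           (blocks X · M) (combine a s) (combine b t)
           ≡ ∑[ a′ < m ] ∑[ s′ < n ] (X a a′ s s′ * M (combine a′ s′) (combine b t))
blocks-· {m} {n} X M a s b t = trans (·-combine (blocks X) M a s b t)
  (sum-cong-≗ (λ (a′ : Fin m) → sum-cong-≗ (λ (s′ : Fin n) →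
    cong (_* M (combine a′ s′) (combine b t)) (blocks-combine X a s a′ s′))))

block : ∀ {m n} → Mat (m ℕ.* n) → Fin m → Fin m → Mat n
block {m} {n} M a b s t = M (combine {m} {n} a s) (combine b t)

detℤ-blocks₂-lower : ∀ n (M : Mat (2 ℕ.* n)) → (∀ s t → block {2} {n} M 0F 1F s t ≡ + 0) →
                     detℤ (2 ℕ.* n) M ≡ detℤ n (block {2} {n} M 0F 0F) * detℤ n (block {2} {n} M 1F 1F)
detℤ-blocks₂-lower n M UR≡0 =
  trans (detℤ-blockLower n (n ℕ.+ 0) M (λ i j →
           subst (λ j → M (i ↑ˡ (n ℕ.+ 0)) (n ↑ʳ j) ≡ + 0) (sym (↑ˡ0-surjective j)) (UR≡0 i _)))
        (cong (detℤ n (block {2} {n} M 0F 0F) *_) (detℤ-+0 n _))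

detℤ-blocks₂-upper : ∀ n (M : Mat (2 ℕ.* n)) → (∀ s t → block {2} {n} M 1F 0F s t ≡ + 0) →
                     detℤ (2 ℕ.* n) M ≡ detℤ n (block {2} {n} M 0F 0F) * detℤ n (block {2} {n} M 1F 1F)
detℤ-blocks₂-upper n M LL≡0 =
  trans (detℤ-blockUpper n (n ℕ.+ 0) M (λ i j →
           subst (λ i → M (n ↑ʳ i) (j ↑ˡ (n ℕ.+ 0)) ≡ + 0) (sym (↑ˡ0-surjective i)) (LL≡0 _ j)))
        (cong (detℤ n (block {2} {n} M 0F 0F) *_) (detℤ-+0 n _))

-- Schur complement: multiplying by [[S, -Q], [0, I]] clears the upper right block, as S and Q commute.
detℤ-blocks₂-commuting : ∀ n (M : Mat (2 ℕ.* n)) →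
  let P = block {2} {n} M 0F 0F; Q = block {2} {n} M 0F 1F; R = block {2} {n} M 1F 0F; S = block {2} {n} M 1F 1F in
  S · Q ≐ Q · S → detℤ n S ≢ + 0 → detℤ (2 ℕ.* n) M ≡ detℤ n (λ i j → (S · P) i j - (Q · R) i j)
detℤ-blocks₂-commuting n M SQ≐QS detS≢0 =
  *-cancelˡ-≢0 detS≢0 (begin
    detℤ n S * detℤ (2 ℕ.* n) M               ≡⟨ cong (_* detℤ (2 ℕ.* n) M) detL ⟨
    detℤ (2 ℕ.* n) L * detℤ (2 ℕ.* n) M       ≡⟨ detℤ-· (2 ℕ.* n) L M ⟨
    detℤ (2 ℕ.* n) (L · M)                    ≡⟨ detℤ-blocks₂-lower n (L · M) LM₀₁ ⟩
    detℤ n (block {2} {n} (L · M) 0F 0F) * detℤ n (block {2} {n} (L · M) 1F 1F)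
                                              ≡⟨ cong₂ _*_ (detℤ-cong n LM₀₀) (detℤ-cong n LM₁₁) ⟩
    detℤ n Schur * detℤ n S                   ≡⟨ ℤP.*-comm (detℤ n Schur) (detℤ n S) ⟩
    detℤ n S * detℤ n Schur                   ∎)
  where
  open ≡-Reasoning
  P Q R S : Mat n
  P = block {2} {n} M 0F 0F
  Q = block {2} {n} M 0F 1F
  R = block {2} {n} M 1F 0F
  S = block {2} {n} M 1F 1F
  Schur : Mat n
  Schur i j = (S · P) i j - (Q · R) i j
  X : Fin 2 → Fin 2 → Mat n
  X 0F 0F = S
  X 0F 1F = λ s t → - Q s t
  X 1F 0F = λ s t → + 0
  X 1F 1F = I n
  L : Mat (2 ℕ.* n)
  L = blocks X
  detL : detℤ (2 ℕ.* n) L ≡ detℤ n S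
  detL = trans (detℤ-blocks₂-upper n L (λ s t → blocks-combine X 1F s 0F t))
               (trans (cong₂ _*_ (detℤ-cong n (λ s t → blocks-combine X 0F s 0F t))
                                 (trans (detℤ-cong n (λ s t → blocks-combine X 1F s 1F t)) (detℤ-I n)))
                      (ℤP.*-identityʳ (detℤ n S)))
  neg-· : ∀ (A B : Mat n) s t → ∑[ s′ < n ] (- A s s′ * B s′ t) ≡ - (A · B) s t
  neg-· A B s t = trans (sum-cong-≗ (λ s′ → sym (ℤP.neg-distribˡ-* (A s s′) (B s′ t))))
                        (sum-neg (λ s′ → A s s′ * B s′ t))
  LM₀₁ : ∀ s t → block {2} {n} (L · M) 0F 1F s t ≡ + 0
  LM₀₁ s t = trans (blocks-· X M 0F s 1F t)
    (trans (cong₂ (λ p q → p + (q + + 0)) (SQ≐QS s t) (neg-· Q S s t))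
      (trans (cong (_+_ ((Q · S) s t)) (ℤP.+-identityʳ (- (Q · S) s t))) (ℤP.+-inverseʳ ((Q · S) s t))))
  LM₀₀ : block {2} {n} (L · M) 0F 0F ≐ Schur
  LM₀₀ s t = trans (blocks-· X M 0F s 0F t)
    (cong (_+_ ((S · P) s t)) (trans (cong (_+ + 0) (neg-· Q R s t)) (ℤP.+-identityʳ (- (Q · R) s t))))
  LM₁₁ : block {2} {n} (L · M) 1F 1F ≐ S
  LM₁₁ s t = trans (blocks-· X M 1F s 1F t)
    (trans (cong₂ (λ p q → p + (q + + 0))
                  (sum-zero (λ s′ → ℤP.*-zeroˡ (M (combine {2} {n} 0F s′) (combine {2} {n} 1F t))))
                  (sum-Iˡ s (λ s′ → S s′ t)))
           (trans (ℤP.+-identityˡ (S s t + + 0)) (ℤP.+-identityʳ (S s t))))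

·-scale-middle : ∀ {m} (K W L : Mat m) a i j → (K · (λ i j → a * W i j) · L) i j ≡ a * (K · W · L) i j
·-scale-middle {m} K W L a i j = begin
  ∑[ j′ < m ] ((∑[ i′ < m ] (K i i′ * (a * W i′ j′))) * L j′ j)
    ≡⟨ sum-cong-≗ (λ j′ → cong (_* L j′ j) (inner j′)) ⟩
  ∑[ j′ < m ] ((a * (K · W) i j′) * L j′ j)
    ≡⟨ sum-cong-≗ (λ j′ → ℤP.*-assoc a ((K · W) i j′) (L j′ j)) ⟩
  ∑[ j′ < m ] (a * ((K · W) i j′ * L j′ j))
    ≡⟨ sum-*ˡ a (λ j′ → (K · W) i j′ * L j′ j) ⟩
  a * (K · W · L) i j ∎
  where
  open ≡-Reasoning
  inner : ∀ j′ → ∑[ i′ < m ] (K i i′ * (a * W i′ j′)) ≡ a * (K · W) i j′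
  inner j′ = trans (sum-cong-≗ (λ i′ → solve 3 (λ k a w → k :* (a :* w) := a :* (k :* w)) refl (K i i′) a (W i′ j′)))
                   (sum-*ˡ a (λ i′ → K i i′ * W i′ j′))

⊗I-· : ∀ {m n} (K : Mat m) (Y : Mat (m ℕ.* n)) (a : Fin m) (s : Fin n) (b : Fin m) (t : Fin n) →
       ((K ⊗ I n) · Y) (combine a s) (combine b t) ≡ ∑[ a′ < m ] (K a a′ * Y (combine a′ s) (combine b t))
⊗I-· {m} {n} K Y a s b t = trans (·-combine (K ⊗ I n) Y a s b t) (sum-cong-≗ λ a′ → begin
  ∑[ s′ < n ] ((K ⊗ I n) (combine a s) (combine a′ s′) * Y (combine a′ s′) (combine b t))
      ≡⟨ sum-cong-≗ (λ s′ → trans (cong (_* Y (combine a′ s′) (combine b t)) (⊗-combine K (I n) a s a′ s′))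
                                  (ℤP.*-assoc (K a a′) (I n s s′) (Y (combine a′ s′) (combine b t)))) ⟩
  ∑[ s′ < n ] (K a a′ * (I n s s′ * Y (combine a′ s′) (combine b t)))
      ≡⟨ sum-*ˡ (K a a′) (λ s′ → I n s s′ * Y (combine a′ s′) (combine b t)) ⟩
  K a a′ * ∑[ s′ < n ] (I n s s′ * Y (combine a′ s′) (combine b t))
      ≡⟨ cong (K a a′ *_) (sum-Iˡ s (λ s′ → Y (combine a′ s′) (combine b t))) ⟩
  K a a′ * Y (combine a′ s) (combine b t)  ∎)
  where open ≡-Reasoning

·-⊗I : ∀ {m n} (L : Mat m) (Y : Mat (m ℕ.* n)) (a : Fin m) (s : Fin n) (b : Fin m) (t : Fin n) →
       (Y · (L ⊗ I n)) (combine a s) (combine b t) ≡ ∑[ b′ < m ] (Y (combine a s) (combine b′ t) * L b′ b)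
·-⊗I {m} {n} L Y a s b t = trans (·-combine Y (L ⊗ I n) a s b t) (sum-cong-≗ λ b′ → begin
  ∑[ t′ < n ] (Y (combine a s) (combine b′ t′) * (L ⊗ I n) (combine b′ t′) (combine b t))
      ≡⟨ sum-cong-≗ (λ t′ → trans (cong (Y (combine a s) (combine b′ t′) *_) (⊗-combine L (I n) b′ t′ b t))
                                  (solve 3 (λ y l i → y :* (l :* i) := (y :* i) :* l) refl
                                         (Y (combine a s) (combine b′ t′)) (L b′ b) (I n t′ t))) ⟩
  ∑[ t′ < n ] ((Y (combine a s) (combine b′ t′) * I n t′ t) * L b′ b)
      ≡⟨ sum-*ʳ (L b′ b) (λ t′ → Y (combine a s) (combine b′ t′) * I n t′ t) ⟩
  (∑[ t′ < n ] (Y (combine a s) (combine b′ t′) * I n t′ t)) * L b′ b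
      ≡⟨ cong (_* L b′ b) (sum-Iʳ t (λ t′ → Y (combine a s) (combine b′ t′))) ⟩
  Y (combine a s) (combine b′ t) * L b′ b  ∎)
  where open ≡-Reasoning

⊗I-conj : ∀ {m n} (K L : Mat m) (Y : Mat (m ℕ.* n)) (a : Fin m) (s : Fin n) (b : Fin m) (t : Fin n) →
          ((K ⊗ I n) · Y · (L ⊗ I n)) (combine a s) (combine b t)
          ≡ (K · (λ a′ b′ → Y (combine a′ s) (combine b′ t)) · L) a b
⊗I-conj K L Y a s b t =
  trans (·-⊗I L ((K ⊗ I _) · Y) a s b t) (sum-cong-≗ (λ b′ → cong (_* L b′ b) (⊗I-· K Y a s b′ t)))

H₂ : Mat 2
H₂ 1F 1F = - + 1
H₂ _  _  = + 1

C₂ : Mat 2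
C₂ a b = + 2 * I 2 a b - + 1

charMat : ∀ {n} → ℤ → Mat n → Mat n
charMat {n} x M i j = x * I n i j - M i j

H₂·H₂ : ∀ a b → (H₂ · H₂) a b ≡ + 2 * I 2 a b
H₂·H₂ 0F 0F = refl
H₂·H₂ 0F 1F = refl
H₂·H₂ 1F 0F = refl
H₂·H₂ 1F 1F = refl

-- Syntactic copies of 2W and of the entries of H₂ · W · H₂, for the ring solver.
private
  2Wᴾ : ∀ {k} → (x d u v : Polynomial k) → Fin 2 → Fin 2 → Polynomial k
  2Wᴾ x d u v a b = con (+ 2) :* x :* (con (I 2 a b) :* d) :- (u :+ con (C₂ a b) :* v)

  sandwichᴾ : ∀ {k} → Fin 2 → Fin 2 → (Fin 2 → Fin 2 → Polynomial k) → Polynomial k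
  sandwichᴾ a b W = (con (H₂ a 0F) :* W 0F 0F :+ (con (H₂ a 1F) :* W 1F 0F :+ con (+ 0))) :* con (H₂ 0F b)
                    :+ ((con (H₂ a 0F) :* W 0F 1F :+ (con (H₂ a 1F) :* W 1F 1F :+ con (+ 0))) :* con (H₂ 1F b) :+ con (+ 0))

module _ (x d u v : ℤ) where

  -- Twice the 2 × 2 pattern of entries of x I - M, when 2 M = J₂ ⊗ U + C₂ ⊗ V.
  2W : Mat 2
  2W a b = + 2 * x * (I 2 a b * d) - (u + C₂ a b * v)

  Z₂ : Mat 2
  Z₂ 0F 0F = x * d - u
  Z₂ 1F 1F = x * d - v
  Z₂ _  _  = + 0

  H₂·2W·H₂ : ∀ a b → (H₂ · 2W · H₂) a b ≡ + 4 * Z₂ a b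
  H₂·2W·H₂ 0F 0F = solve 4 (λ x d u v → sandwichᴾ 0F 0F (2Wᴾ x d u v) := con (+ 4) :* (x :* d :- u)) refl x d u v
  H₂·2W·H₂ 0F 1F = solve 4 (λ x d u v → sandwichᴾ 0F 1F (2Wᴾ x d u v) := con (+ 4) :* con (+ 0)) refl x d u v
  H₂·2W·H₂ 1F 0F = solve 4 (λ x d u v → sandwichᴾ 1F 0F (2Wᴾ x d u v) := con (+ 4) :* con (+ 0)) refl x d u v
  H₂·2W·H₂ 1F 1F = solve 4 (λ x d u v → sandwichᴾ 1F 1F (2Wᴾ x d u v) := con (+ 4) :* (x :* d :- v)) refl x d u v

detℤ-H₂⊗I-squared : ∀ n → detℤ (2 ℕ.* n) (H₂ ⊗ I n) * detℤ (2 ℕ.* n) (H₂ ⊗ I n) ≡ (+ 2) ^ (2 ℕ.* n)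
detℤ-H₂⊗I-squared n = begin
  detℤ N H̃ * detℤ N H̃                  ≡⟨ detℤ-· N H̃ H̃ ⟨
  detℤ N (H̃ · H̃)                       ≡⟨ detℤ-cong N (≐-combine square) ⟩
  detℤ N (λ i j → + 2 * I N i j)       ≡⟨ detℤ-* N (+ 2) (I N) ⟩
  (+ 2) ^ N * detℤ N (I N)             ≡⟨ cong ((+ 2) ^ N *_) (detℤ-I N) ⟩
  (+ 2) ^ N * + 1                      ≡⟨ ℤP.*-identityʳ ((+ 2) ^ N) ⟩
  (+ 2) ^ N                            ∎
  where
  open ≡-Reasoning
  N = 2 ℕ.* n
  H̃ : Mat N
  H̃ = H₂ ⊗ I n
  square : ∀ a s b t → (H̃ · H̃) (combine a s) (combine b t) ≡ + 2 * I N (combine a s) (combine b t)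
  square a s b t = begin
    (H̃ · H̃) (combine a s) (combine b t)                     ≡⟨ ⊗I-· H₂ H̃ a s b t ⟩
    ∑[ a′ < 2 ] (H₂ a a′ * H̃ (combine a′ s) (combine b t))
      ≡⟨ sum-cong-≗ (λ a′ → cong (H₂ a a′ *_) (⊗-combine H₂ (I n) a′ s b t)) ⟩
    ∑[ a′ < 2 ] (H₂ a a′ * (H₂ a′ b * I n s t))
      ≡⟨ sum-cong-≗ (λ a′ → sym (ℤP.*-assoc (H₂ a a′) (H₂ a′ b) (I n s t))) ⟩
    ∑[ a′ < 2 ] (H₂ a a′ * H₂ a′ b * I n s t)               ≡⟨ sum-*ʳ (I n s t) (λ a′ → H₂ a a′ * H₂ a′ b) ⟩
    (H₂ · H₂) a b * I n s t                                 ≡⟨ cong (_* I n s t) (H₂·H₂ a b) ⟩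
    + 2 * I 2 a b * I n s t                                 ≡⟨ ℤP.*-assoc (+ 2) (I 2 a b) (I n s t) ⟩
    + 2 * (I 2 a b * I n s t)                               ≡⟨ cong (+ 2 *_) (I-combine a b s t) ⟨
    + 2 * I N (combine a s) (combine b t)                   ∎

module _ {n} (M : Mat (2 ℕ.* n)) (U V : Mat n)
  (2M≡ : ∀ a b s t → + 2 * M (combine a s) (combine b t) ≡ U s t + C₂ a b * V s t) (x : ℤ) where

  private
    N = 2 ℕ.* n
    H̃ X : Mat N
    H̃ = H₂ ⊗ I n
    X = charMat x M

  charBlocks : Fin 2 → Fin 2 → Mat n
  charBlocks a b s t = Z₂ x (I n s t) (U s t) (V s t) a b

  H₂⊗I-conj-charMat : H̃ · X · H̃ ≐ λ i j → + 2 * blocks charBlocks i j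
  H₂⊗I-conj-charMat = ≐-combine λ a s b t → *-cancelˡ-≢0 {+ 2} (λ ()) (begin
    + 2 * (H̃ · X · H̃) (combine a s) (combine b t)           ≡⟨ cong (+ 2 *_) (⊗I-conj H₂ H₂ X a s b t) ⟩
    + 2 * (H₂ · W s t · H₂) a b                              ≡⟨ ·-scale-middle H₂ (W s t) H₂ (+ 2) a b ⟨
    (H₂ · (λ a′ b′ → + 2 * W s t a′ b′) · H₂) a b
      ≡⟨ ·-cong (·-cong (≐-refl {M = H₂}) (2W≐ s t)) (≐-refl {M = H₂}) a b ⟩
    (H₂ · 2W x (I n s t) (U s t) (V s t) · H₂) a b           ≡⟨ H₂·2W·H₂ x (I n s t) (U s t) (V s t) a b ⟩
    + 4 * charBlocks a b s t                                 ≡⟨ cong (+ 4 *_) (blocks-combine charBlocks a s b t) ⟨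
    + 4 * blocks charBlocks (combine a s) (combine b t)
      ≡⟨ ℤP.*-assoc (+ 2) (+ 2) (blocks charBlocks (combine a s) (combine b t)) ⟩
    + 2 * (+ 2 * blocks charBlocks (combine a s) (combine b t)) ∎)
    where
    open ≡-Reasoning
    W : Fin n → Fin n → Mat 2
    W s t a′ b′ = X (combine a′ s) (combine b′ t)
    2W≐ : ∀ s t → (λ a′ b′ → + 2 * W s t a′ b′) ≐ 2W x (I n s t) (U s t) (V s t)
    2W≐ s t a′ b′ = begin
      + 2 * (x * I N (combine a′ s) (combine b′ t) - M (combine a′ s) (combine b′ t))
        ≡⟨ solve 3 (λ x i m → con (+ 2) :* (x :* i :- m) := con (+ 2) :* x :* i :- con (+ 2) :* m) refl
                 x (I N (combine a′ s) (combine b′ t)) (M (combine a′ s) (combine b′ t)) ⟩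
      + 2 * x * I N (combine a′ s) (combine b′ t) - + 2 * M (combine a′ s) (combine b′ t)
        ≡⟨ cong₂ (λ i m → + 2 * x * i - m) (I-combine a′ b′ s t) (2M≡ a′ b′ s t) ⟩
      2W x (I n s t) (U s t) (V s t) a′ b′ ∎

  detℤ-charMat-split : detℤ N (charMat x M) ≡ detℤ n (charMat x U) * detℤ n (charMat x V)
  detℤ-charMat-split = *-cancelˡ-≢0 (^≢0 N (λ ())) (begin
    (+ 2) ^ N * detℤ N X                           ≡⟨ cong (_* detℤ N X) (detℤ-H₂⊗I-squared n) ⟨
    detℤ N H̃ * detℤ N H̃ * detℤ N X
      ≡⟨ solve 2 (λ h y → h :* h :* y := h :* y :* h) refl (detℤ N H̃) (detℤ N X) ⟩
    detℤ N H̃ * detℤ N X * detℤ N H̃                ≡⟨ cong (_* detℤ N H̃) (detℤ-· N H̃ X) ⟨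
    detℤ N (H̃ · X) * detℤ N H̃                     ≡⟨ detℤ-· N (H̃ · X) H̃ ⟨
    detℤ N (H̃ · X · H̃)                            ≡⟨ detℤ-cong N H₂⊗I-conj-charMat ⟩
    detℤ N (λ i j → + 2 * blocks charBlocks i j)  ≡⟨ detℤ-* N (+ 2) (blocks charBlocks) ⟩
    (+ 2) ^ N * detℤ N (blocks charBlocks)         ≡⟨ cong ((+ 2) ^ N *_) block-diagonal ⟩
    (+ 2) ^ N * (detℤ n (charMat x U) * detℤ n (charMat x V)) ∎)
    where
    open ≡-Reasoning
    block-diagonal : detℤ N (blocks charBlocks) ≡ detℤ n (charMat x U) * detℤ n (charMat x V)
    block-diagonal = trans (detℤ-blocks₂-lower n (blocks charBlocks) (λ s t → blocks-combine charBlocks 0F s 1F t))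
                           (cong₂ _*_ (detℤ-cong n (λ s t → blocks-combine charBlocks 0F s 0F t))
                                      (detℤ-cong n (λ s t → blocks-combine charBlocks 1F s 1F t)))

-- The matrices B^{⊗k}

⊗-· : ∀ {m n} (K L : Mat m) (P Q : Mat n) (a : Fin m) (s : Fin n) (b : Fin m) (t : Fin n) →
      ((K ⊗ P) · (L ⊗ Q)) (combine a s) (combine b t) ≡ (K · L) a b * (P · Q) s t
⊗-· {m} {n} K L P Q a s b t = begin
  ((K ⊗ P) · (L ⊗ Q)) (combine a s) (combine b t)
    ≡⟨ ·-combine (K ⊗ P) (L ⊗ Q) a s b t ⟩
  ∑[ a′ < m ] ∑[ s′ < n ] ((K ⊗ P) (combine a s) (combine a′ s′) * (L ⊗ Q) (combine a′ s′) (combine b t))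
    ≡⟨ sum-cong-≗ (λ a′ → sum-cong-≗ (λ s′ →
         cong₂ _*_ (⊗-combine K P a s a′ s′) (⊗-combine L Q a′ s′ b t))) ⟩
  ∑[ a′ < m ] ∑[ s′ < n ] ((K a a′ * P s s′) * (L a′ b * Q s′ t))
    ≡⟨ sum-cong-≗ (λ a′ → trans (sum-cong-≗ (λ s′ → interchange (K a a′) (P s s′) (L a′ b) (Q s′ t)))
                                (sum-*ˡ (K a a′ * L a′ b) (λ s′ → P s s′ * Q s′ t))) ⟩
  ∑[ a′ < m ] ((K a a′ * L a′ b) * (P · Q) s t)
    ≡⟨ sum-*ʳ ((P · Q) s t) (λ a′ → K a a′ * L a′ b) ⟩
  (K · L) a b * (P · Q) s t ∎
  where
  open ≡-Reasoning
  interchange : ∀ w x y z → (w * x) * (y * z) ≡ (w * y) * (x * z)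
  interchange = solve 4 (λ w x y z → (w :* x) :* (y :* z) := (w :* y) :* (x :* z)) refl

B^⊗ : (k : ℕ) → Mat (2 ℕ.^ k)
B^⊗ zero    = J 1
B^⊗ (suc k) = B ⊗ B^⊗ k

B·B : ∀ a b → (B · B) a b ≡ + 2 * I 2 a b
B·B 0F 0F = refl
B·B 0F 1F = refl
B·B 1F 0F = refl
B·B 1F 1F = refl

B^⊗-square : ∀ k → B^⊗ k · B^⊗ k ≐ λ i j → (+ 2) ^ k * I (2 ℕ.^ k) i j
B^⊗-square zero    0F 0F = refl
B^⊗-square (suc k) = ≐-combine λ a s b t → begin
  (B^⊗ (suc k) · B^⊗ (suc k)) (combine a s) (combine b t)
    ≡⟨ ⊗-· B B (B^⊗ k) (B^⊗ k) a s b t ⟩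
  (B · B) a b * (B^⊗ k · B^⊗ k) s t
    ≡⟨ cong₂ _*_ (B·B a b) (B^⊗-square k s t) ⟩
  (+ 2 * I 2 a b) * ((+ 2) ^ k * I (2 ℕ.^ k) s t)
    ≡⟨ solve 3 (λ a b p → (con (+ 2) :* a) :* (p :* b) := (con (+ 2) :* p) :* (a :* b))
             refl (I 2 a b) (I (2 ℕ.^ k) s t) ((+ 2) ^ k) ⟩
  (+ 2) ^ suc k * (I 2 a b * I (2 ℕ.^ k) s t)
    ≡⟨ cong ((+ 2) ^ suc k *_) (I-combine a b s t) ⟨
  (+ 2) ^ suc k * I (2 ℕ.^ suc k) (combine a s) (combine b t) ∎
  where open ≡-Reasoning

linear : ∀ {n} → ℤ → ℤ → Mat n → Mat n
linear {n} α β G i j = α * I n i j + β * G i j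

linear-· : ∀ {n} (α β : ℤ) (G N : Mat n) → linear α β G · N ≐ λ i j → α * N i j + β * (G · N) i j
linear-· {n} α β G N i j = begin
  ∑[ t < n ] ((α * I n i t + β * G i t) * N t j)
    ≡⟨ sum-cong-≗ (λ t → distrib (I n i t) (G i t) (N t j)) ⟩
  ∑[ t < n ] (α * (I n i t * N t j) + β * (G i t * N t j))
    ≡⟨ ∑-distrib-+ (λ t → α * (I n i t * N t j)) (λ t → β * (G i t * N t j)) ⟩
  ∑[ t < n ] (α * (I n i t * N t j)) + ∑[ t < n ] (β * (G i t * N t j))
    ≡⟨ cong₂ _+_ (sum-*ˡ α (λ t → I n i t * N t j)) (sum-*ˡ β (λ t → G i t * N t j)) ⟩
  α * (I n · N) i j + β * (G · N) i j
    ≡⟨ cong (λ z → α * z + β * (G · N) i j) (I-· N i j) ⟩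
  α * N i j + β * (G · N) i j ∎
  where
  open ≡-Reasoning
  distrib : ∀ e g z → (α * e + β * g) * z ≡ α * (e * z) + β * (g * z)
  distrib e g z = solve 5 (λ α β e g z → (α :* e :+ β :* g) :* z := α :* (e :* z) :+ β :* (g :* z)) refl α β e g z

·-linear : ∀ {n} (α β : ℤ) (G N : Mat n) → N · linear α β G ≐ λ i j → α * N i j + β * (N · G) i j
·-linear {n} α β G N i j = begin
  ∑[ t < n ] (N i t * (α * I n t j + β * G t j))
    ≡⟨ sum-cong-≗ (λ t → distrib (N i t) (I n t j) (G t j)) ⟩
  ∑[ t < n ] (α * (N i t * I n t j) + β * (N i t * G t j))
    ≡⟨ ∑-distrib-+ (λ t → α * (N i t * I n t j)) (λ t → β * (N i t * G t j)) ⟩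
  ∑[ t < n ] (α * (N i t * I n t j)) + ∑[ t < n ] (β * (N i t * G t j))
    ≡⟨ cong₂ _+_ (sum-*ˡ α (λ t → N i t * I n t j)) (sum-*ˡ β (λ t → N i t * G t j)) ⟩
  α * (N · I n) i j + β * (N · G) i j
    ≡⟨ cong (λ z → α * z + β * (N · G) i j) (·-I N i j) ⟩
  α * N i j + β * (N · G) i j ∎
  where
  open ≡-Reasoning
  distrib : ∀ z e g → z * (α * e + β * g) ≡ α * (z * e) + β * (z * g)
  distrib z e g = solve 5 (λ α β z e g → z :* (α :* e :+ β :* g) := α :* (z :* e) :+ β :* (z :* g)) refl α β z e g

linear-·-linear : ∀ {n} (G : Mat n) m → G · G ≐ (λ i j → m * I n i j) → ∀ α₁ β₁ α₂ β₂ →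
  linear α₁ β₁ G · linear α₂ β₂ G ≐ linear (α₁ * α₂ + β₁ * β₂ * m) (α₁ * β₂ + β₁ * α₂) G
linear-·-linear {n} G m G² α₁ β₁ α₂ β₂ i j = begin
  (linear α₁ β₁ G · linear α₂ β₂ G) i j
    ≡⟨ linear-· α₁ β₁ G (linear α₂ β₂ G) i j ⟩
  α₁ * linear α₂ β₂ G i j + β₁ * (G · linear α₂ β₂ G) i j
    ≡⟨ cong (λ z → α₁ * linear α₂ β₂ G i j + β₁ * z) (·-linear α₂ β₂ G G i j) ⟩
  α₁ * linear α₂ β₂ G i j + β₁ * (α₂ * G i j + β₂ * (G · G) i j)
    ≡⟨ cong (λ z → α₁ * linear α₂ β₂ G i j + β₁ * (α₂ * G i j + β₂ * z)) (G² i j) ⟩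
  α₁ * (α₂ * e + β₂ * g) + β₁ * (α₂ * g + β₂ * (m * e))
    ≡⟨ solve 7 (λ α₁ β₁ α₂ β₂ m e g → α₁ :* (α₂ :* e :+ β₂ :* g) :+ β₁ :* (α₂ :* g :+ β₂ :* (m :* e))
                                    := (α₁ :* α₂ :+ β₁ :* β₂ :* m) :* e :+ (α₁ :* β₂ :+ β₁ :* α₂) :* g)
             refl α₁ β₁ α₂ β₂ m e g ⟩
  linear (α₁ * α₂ + β₁ * β₂ * m) (α₁ * β₂ + β₁ * α₂) G i j ∎
  where
  open ≡-Reasoning
  e = I n i j
  g = G i j

linear-cong : ∀ {n} {α α′ β β′ : ℤ} (G : Mat n) → α ≡ α′ → β ≡ β′ → linear α β G ≐ linear α′ β′ G
linear-cong G refl refl i j = refl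

linear-·-comm : ∀ {n} (G : Mat n) m → G · G ≐ (λ i j → m * I n i j) → ∀ α₁ β₁ α₂ β₂ →
                linear α₁ β₁ G · linear α₂ β₂ G ≐ linear α₂ β₂ G · linear α₁ β₁ G
linear-·-comm G m G² α₁ β₁ α₂ β₂ = ≐-trans (linear-·-linear G m G² α₁ β₁ α₂ β₂)
  (≐-trans (linear-cong G (solve 5 (λ a₁ b₁ a₂ b₂ m → a₁ :* a₂ :+ b₁ :* b₂ :* m := a₂ :* a₁ :+ b₂ :* b₁ :* m)
                                   refl α₁ β₁ α₂ β₂ m)
                          (solve 4 (λ a₁ b₁ a₂ b₂ → a₁ :* b₂ :+ b₁ :* a₂ := a₂ :* b₁ :+ b₂ :* a₁)
                                   refl α₁ β₁ α₂ β₂))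
           (≐-sym (linear-·-linear G m G² α₂ β₂ α₁ β₁)))

block-linear-⊗ : ∀ {n} α β (K : Mat 2) (G : Mat n) a b →
                 block {2} {n} (linear α β (K ⊗ G)) a b ≐ linear (α * I 2 a b) (β * K a b) G
block-linear-⊗ {n} α β K G a b s t =
  trans (cong₂ (λ e g → α * e + β * g) (I-combine a b s t) (⊗-combine K G a s b t))
        (solve 6 (λ α β e f k g → α :* (e :* f) :+ β :* (k :* g) := α :* e :* f :+ β :* k :* g) refl
               α β (I 2 a b) (I n s t) (K a b) (G s t))

odd²-even≢0 : ∀ y c k → odd y * odd y - c * c * (+ 2) ^ suc k ≢ + 0
odd²-even≢0 y c k = odd≢0 (+ 2 * y + + 2 * y * y - c * c * (+ 2) ^ k) ∘ trans
  (solve 3 (λ y c p → con (+ 1) :+ con (+ 2) :* (con (+ 2) :* y :+ con (+ 2) :* y :* y :- c :* c :* p)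
                   := (con (+ 1) :+ con (+ 2) :* y) :* (con (+ 1) :+ con (+ 2) :* y) :- c :* c :* (con (+ 2) :* p))
         refl y c ((+ 2) ^ k))

module LinearB⊗ {n} (G : Mat n) (m : ℤ) (G² : G · G ≐ λ i j → m * I n i j) (α β : ℤ) where

  M : Mat (2 ℕ.* n)
  M = linear α β (B ⊗ G)

  P Q R S : Mat n
  P = block {2} {n} M 0F 0F
  Q = block {2} {n} M 0F 1F
  R = block {2} {n} M 1F 0F
  S = block {2} {n} M 1F 1F

  block≐ : ∀ a b → block {2} {n} M a b ≐ linear (α * I 2 a b) (β * B a b) G
  block≐ = block-linear-⊗ α β B G

  private
    product : ∀ a b a′ b′ → block {2} {n} M a b · block {2} {n} M a′ b′
              ≐ linear (α * I 2 a b * (α * I 2 a′ b′) + β * B a b * (β * B a′ b′) * m)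
                       (α * I 2 a b * (β * B a′ b′) + β * B a b * (α * I 2 a′ b′)) G
    product a b a′ b′ = ≐-trans (·-cong (block≐ a b) (block≐ a′ b′))
                                (linear-·-linear G m G² (α * I 2 a b) (β * B a b) (α * I 2 a′ b′) (β * B a′ b′))

  S·Q≐Q·S : S · Q ≐ Q · S
  S·Q≐Q·S = ≐-trans (·-cong (block≐ 1F 1F) (block≐ 0F 1F))
              (≐-trans (linear-·-comm G m G² (α * + 1) (β * - + 1) (α * + 0) (β * - + 1))
                       (≐-sym (·-cong (block≐ 0F 1F) (block≐ 1F 1F))))

  schur : (λ i j → (S · P) i j - (Q · R) i j) ≐ λ i j → (α * α - β * β * (+ 2 * m)) * I n i j
  schur i j = trans (cong₂ _-_ (product 1F 1F 0F 0F i j) (product 0F 1F 1F 0F i j))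
    (solve 5 (λ α β m e g →
        (α :* con (+ 1) :* (α :* con (+ 1)) :+ β :* con (- + 1) :* (β :* con (+ 1)) :* m) :* e
          :+ (α :* con (+ 1) :* (β :* con (+ 1)) :+ β :* con (- + 1) :* (α :* con (+ 1))) :* g
        :- ((α :* con (+ 0) :* (α :* con (+ 0)) :+ β :* con (- + 1) :* (β :* con (- + 1)) :* m) :* e
          :+ (α :* con (+ 0) :* (β :* con (- + 1)) :+ β :* con (- + 1) :* (α :* con (+ 0))) :* g)
        := (α :* α :- β :* β :* (con (+ 2) :* m)) :* e) refl α β m (I n i j) (G i j))

-- At odd x the Schur complement is available, since every x² - c² 2^(k+1) is odd.
detℤ-linear-B^⊗ : ∀ y k c → detℤ (2 ℕ.^ suc k) (linear (odd y) (- c) (B^⊗ (suc k)))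
                            ≡ (odd y * odd y - c * c * (+ 2) ^ suc k) ^ (2 ℕ.^ k)
detℤ-linear-B^⊗ y zero c =
  solve 2 (λ x c → con (+ 1) :* (m x c 0F 0F :* (con (+ 1) :* (m x c 1F 1F :* con (+ 1)) :+ con (+ 0)))
                   :+ (con (- + 1) :* (m x c 0F 1F :* (con (+ 1) :* (m x c 1F 0F :* con (+ 1)) :+ con (+ 0))) :+ con (+ 0))
                := (x :* x :- c :* c :* (con (+ 2) :* con (+ 1))) :* con (+ 1))
        refl (odd y) c
  where
  m : ∀ {k} → Polynomial k → Polynomial k → Fin 2 → Fin 2 → Polynomial k
  m x c a b = x :* con (I 2 a b) :+ :- c :* (con (B a b) :* con (+ 1))
detℤ-linear-B^⊗ y (suc k) c = begin
  detℤ (2 ℕ.* n) M                                       ≡⟨ detℤ-blocks₂-commuting n M S·Q≐Q·S det-S≢0 ⟩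
  detℤ n (λ i j → (S · P) i j - (Q · R) i j)             ≡⟨ detℤ-cong n schur ⟩
  detℤ n (λ i j → (x * x - - c * - c * (+ 2 * m)) * I n i j)
                                                         ≡⟨ detℤ-scalar n (x * x - - c * - c * (+ 2 * m)) ⟩
  (x * x - - c * - c * (+ 2 * m)) ^ n                    ≡⟨ cong (_^ n) (solve 3 (λ x c m → x :* x :- :- c :* :- c :* m := x :* x :- c :* c :* m)
                                                                                 refl x c (+ 2 * m)) ⟩
  (x * x - c * c * (+ 2) ^ suc (suc k)) ^ n              ∎
  where
  open ≡-Reasoning
  x = odd y
  n = 2 ℕ.^ suc k
  m = (+ 2) ^ suc k
  open LinearB⊗ (B^⊗ (suc k)) m (B^⊗-square (suc k)) x (- c)
  det-S≢0 : detℤ n S ≢ + 0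
  det-S≢0 = ^≢0 (2 ℕ.^ k) (odd²-even≢0 y (- c) k) ∘ trans (sym (detℤ-linear-B^⊗ y k (- c)))
    ∘ trans (detℤ-cong n (≐-sym (≐-trans (block≐ 1F 1F) (linear-cong (B^⊗ (suc k)) (ℤP.*-identityʳ x)
                                    (solve 1 (λ c → :- c :* con (- + 1) := :- (:- c)) refl c)))))

^-pred-double : ∀ (x d : ℤ) n → 1 ≤ n → x ^ (n ∸ 1) * (x - d) * x ^ n ≡ x ^ (2 ℕ.* n ∸ 1) * (x - d)
^-pred-double x d (suc m) _ = begin
  x ^ m * (x - d) * x ^ suc m
    ≡⟨ solve 3 (λ p q r → p :* q :* r := p :* r :* q) refl (x ^ m) (x - d) (x ^ suc m) ⟩
  x ^ m * x ^ suc m * (x - d)             ≡⟨ cong (_* (x - d)) (ℤP.^-distribˡ-+-* x m (suc m)) ⟨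
  x ^ (m ℕ.+ suc m) * (x - d)             ≡⟨ cong (λ e → x ^ (m ℕ.+ e) * (x - d)) (ℕP.+-identityʳ (suc m)) ⟨
  x ^ (m ℕ.+ (suc m ℕ.+ 0)) * (x - d)     ∎
  where open ≡-Reasoning

-- J on 2^(k+1) points is J₂ ⊗ J, and its C₂-part vanishes.
detℤ-charMat-J : ∀ x k c → detℤ (2 ℕ.^ k) (charMat x (λ i j → c * J (2 ℕ.^ k) i j))
                           ≡ x ^ (2 ℕ.^ k ∸ 1) * (x - c * (+ 2) ^ k)
detℤ-charMat-J x zero    c =
  solve 2 (λ x c → con (+ 1) :* ((x :* con (+ 1) :- c :* con (+ 1)) :* con (+ 1)) :+ con (+ 0)
                := con (+ 1) :* (x :- c :* con (+ 1))) refl x c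
detℤ-charMat-J x (suc k) c = begin
  detℤ (2 ℕ.* n) (charMat x (λ i j → c * J (2 ℕ.* n) i j))
    ≡⟨ detℤ-charMat-split (λ i j → c * J (2 ℕ.* n) i j) (λ s t → + 2 * c * J n s t) (λ _ _ → + 0) J-halves x ⟩
  detℤ n (charMat x (λ s t → + 2 * c * J n s t)) * detℤ n (charMat x (λ _ _ → + 0))
    ≡⟨ cong₂ _*_ (detℤ-charMat-J x k (+ 2 * c))
                 (trans (detℤ-cong n (λ s t → ℤP.+-identityʳ (x * I n s t))) (detℤ-scalar n x)) ⟩
  x ^ (n ∸ 1) * (x - + 2 * c * (+ 2) ^ k) * x ^ n
    ≡⟨ cong (λ d → x ^ (n ∸ 1) * (x - d) * x ^ n)
            (solve 2 (λ c p → con (+ 2) :* c :* p := c :* (con (+ 2) :* p)) refl c ((+ 2) ^ k)) ⟩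
  x ^ (n ∸ 1) * (x - c * (+ 2) ^ suc k) * x ^ n
    ≡⟨ ^-pred-double x (c * (+ 2) ^ suc k) n (ℕP.m^n>0 2 k) ⟩
  x ^ (2 ℕ.^ suc k ∸ 1) * (x - c * (+ 2) ^ suc k) ∎
  where
  open ≡-Reasoning
  n = 2 ℕ.^ k
  J-halves : ∀ a b s t → + 2 * (c * + 1) ≡ + 2 * c * + 1 + C₂ a b * + 0
  J-halves a b s t = solve 2 (λ c e → con (+ 2) :* (c :* con (+ 1)) := con (+ 2) :* c :* con (+ 1) :+ e :* con (+ 0))
                           refl c (C₂ a b)

-- The matrices A_k

-- The index of Fin (2^(k+1)) whose binary expansion is that of s followed by the digit p.
snoc : ∀ {k} → Fin (2 ℕ.^ k) → Fin 2 → Fin (2 ℕ.^ suc k)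
snoc {k} s p = cast (ℕP.*-comm (2 ℕ.^ k) 2) (combine s p)

snoc-surjective : ∀ {k} (i : Fin (2 ℕ.^ suc k)) → ∃₂ λ s p → snoc {k} s p ≡ i
snoc-surjective {k} i =
  let s , p , e = combine-surjective {2 ℕ.^ k} {2} (cast (sym comm) i)
  in s , p , trans (cong (cast comm) e) (cast-involutive comm (sym comm) i)
  where comm = ℕP.*-comm (2 ℕ.^ k) 2

combine-snoc : ∀ {k} (a : Fin 2) (s : Fin (2 ℕ.^ k)) (p : Fin 2) →
               combine {2} {2 ℕ.^ suc k} a (snoc {k} s p) ≡ snoc {suc k} (combine a s) p
combine-snoc {k} a s p = toℕ-injective (begin
  toℕ (combine a (snoc {k} s p))
    ≡⟨ toℕ-combine a (snoc {k} s p) ⟩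
  2 ℕ.^ suc k ℕ.* toℕ a ℕ.+ toℕ (snoc {k} s p)
    ≡⟨ cong (2 ℕ.^ suc k ℕ.* toℕ a ℕ.+_) (toℕ-snoc {k} s p) ⟩
  2 ℕ.* 2 ℕ.^ k ℕ.* toℕ a ℕ.+ (2 ℕ.* toℕ s ℕ.+ toℕ p)
    ≡⟨ cong (ℕ._+ (2 ℕ.* toℕ s ℕ.+ toℕ p)) (ℕP.*-assoc 2 (2 ℕ.^ k) (toℕ a)) ⟩
  2 ℕ.* (2 ℕ.^ k ℕ.* toℕ a) ℕ.+ (2 ℕ.* toℕ s ℕ.+ toℕ p)
    ≡⟨ ℕP.+-assoc (2 ℕ.* (2 ℕ.^ k ℕ.* toℕ a)) (2 ℕ.* toℕ s) (toℕ p) ⟨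
  2 ℕ.* (2 ℕ.^ k ℕ.* toℕ a) ℕ.+ 2 ℕ.* toℕ s ℕ.+ toℕ p
    ≡⟨ cong (ℕ._+ toℕ p) (ℕP.*-distribˡ-+ 2 (2 ℕ.^ k ℕ.* toℕ a) (toℕ s)) ⟨
  2 ℕ.* (2 ℕ.^ k ℕ.* toℕ a ℕ.+ toℕ s) ℕ.+ toℕ p
    ≡⟨ cong (λ z → 2 ℕ.* z ℕ.+ toℕ p) (toℕ-combine a s) ⟨
  2 ℕ.* toℕ (combine a s) ℕ.+ toℕ p
    ≡⟨ toℕ-snoc {suc k} (combine a s) p ⟨
  toℕ (snoc {suc k} (combine a s) p) ∎)
  where
  open ≡-Reasoning
  toℕ-snoc : ∀ {k} (s : Fin (2 ℕ.^ k)) p → toℕ (snoc {k} s p) ≡ 2 ℕ.* toℕ s ℕ.+ toℕ p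
  toℕ-snoc {k} s p = trans (toℕ-cast _ (combine s p)) (toℕ-combine s p)

B^⊗-snoc : ∀ k (s t : Fin (2 ℕ.^ k)) (p q : Fin 2) → B^⊗ (suc k) (snoc {k} s p) (snoc {k} t q) ≡ B^⊗ k s t * B p q
B^⊗-snoc zero 0F 0F p q = trans (cong₂ (B^⊗ 1) (snoc₀ p) (snoc₀ q))
                                (trans (⊗-combine B (J 1) p 0F q 0F) (ℤP.*-comm (B p q) (+ 1)))
  where
  snoc₀ : ∀ p → snoc {0} 0F p ≡ combine {2} {1} p 0F
  snoc₀ 0F = refl
  snoc₀ 1F = refl
B^⊗-snoc (suc k) s t p q = ≐-combine {M = λ s t → B^⊗ (suc (suc k)) (snoc {suc k} s p) (snoc {suc k} t q)}
                                      {N = λ s t → B^⊗ (suc k) s t * B p q} (λ a u b v → begin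
  B^⊗ (suc (suc k)) (snoc {suc k} (combine a u) p) (snoc {suc k} (combine b v) q)
    ≡⟨ cong₂ (B^⊗ (suc (suc k))) (combine-snoc {k} a u p) (combine-snoc {k} b v q) ⟨
  (B ⊗ B^⊗ (suc k)) (combine a (snoc {k} u p)) (combine b (snoc {k} v q))
    ≡⟨ ⊗-combine B (B^⊗ (suc k)) a (snoc {k} u p) b (snoc {k} v q) ⟩
  B a b * B^⊗ (suc k) (snoc {k} u p) (snoc {k} v q)
    ≡⟨ cong (B a b *_) (B^⊗-snoc k u v p q) ⟩
  B a b * (B^⊗ k u v * B p q)
    ≡⟨ ℤP.*-assoc (B a b) (B^⊗ k u v) (B p q) ⟨
  B a b * B^⊗ k u v * B p q
    ≡⟨ cong (_* B p q) (⊗-combine B (B^⊗ k) a u b v) ⟨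
  B^⊗ (suc k) (combine a u) (combine b v) * B p q ∎) s t
  where open ≡-Reasoning

-- This makes the halving in the definition of A_{k+1} exact.
[2a-1]β+1-even : ∀ a β → β ≡ + 1 ⊎ β ≡ - + 1 → Σ ℤ λ w → (+ 2 * a - + 1) * β + + 1 ≡ + 2 * w
[2a-1]β+1-even a _ (inj₁ refl) =
  a , solve 1 (λ a → (con (+ 2) :* a :- con (+ 1)) :* con (+ 1) :+ con (+ 1) := con (+ 2) :* a) refl a
[2a-1]β+1-even a _ (inj₂ refl) =
  + 1 - a , solve 1 (λ a → (con (+ 2) :* a :- con (+ 1)) :* con (- + 1) :+ con (+ 1) := con (+ 2) :* (con (+ 1) :- a)) refl a

B≡±1 : ∀ p q → B p q ≡ + 1 ⊎ B p q ≡ - + 1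
B≡±1 0F 0F = inj₁ refl
B≡±1 0F 1F = inj₂ refl
B≡±1 1F 0F = inj₂ refl
B≡±1 1F 1F = inj₂ refl

Aseq-suc-snoc : ∀ k (u v : Fin (2 ℕ.^ suc k)) (p q : Fin 2) →
  Aseq (suc k) (snoc {suc k} u p) (snoc {suc k} v q)
  ≡ (((+ 2 * Aseq k u v - + 1) * B p q + + 1) / + 2)
Aseq-suc-snoc k u v p q =
  trans (cong₂ (λ r c → ((E ⊗ B) r c + + 1) / + 2) (cast-involutive (sym e) e u′) (cast-involutive (sym e) e v′))
        (cong (λ z → (z + + 1) / + 2) (⊗-combine E B u p v q))
  where
  e = ℕP.*-comm (2 ℕ.^ suc k) 2
  u′ = combine u p
  v′ = combine v q
  E : Mat (2 ℕ.^ suc k)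
  E i j = + 2 * Aseq k i j - J (2 ℕ.^ suc k) i j

Aseq-entry : ∀ k (a b : Fin 2) (s t : Fin (2 ℕ.^ k)) →
             + 2 * Aseq k (combine a s) (combine b t) ≡ + 1 + C₂ a b * B^⊗ k s t
Aseq-entry zero 0F 0F 0F 0F = refl
Aseq-entry zero 0F 1F 0F 0F = refl
Aseq-entry zero 1F 0F 0F 0F = refl
Aseq-entry zero 1F 1F 0F 0F = refl
Aseq-entry (suc k) a b s′ t′ with snoc-surjective {k} s′ | snoc-surjective {k} t′
... | s , p , refl | t , q , refl = begin
  + 2 * Aseq (suc k) (combine a (snoc {k} s p)) (combine b (snoc {k} t q))
    ≡⟨ cong₂ (λ i j → + 2 * Aseq (suc k) i j) (combine-snoc {k} a s p) (combine-snoc {k} b t q) ⟩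
  + 2 * Aseq (suc k) (snoc {suc k} (combine a s) p) (snoc {suc k} (combine b t) q)
    ≡⟨ cong (+ 2 *_) (Aseq-suc-snoc k (combine a s) (combine b t) p q) ⟩
  + 2 * (((+ 2 * A - + 1) * B p q + + 1) / + 2)
    ≡⟨ 2*[n/2]≡n _ (proj₂ ([2a-1]β+1-even A (B p q) (B≡±1 p q))) ⟩
  (+ 2 * A - + 1) * B p q + + 1
    ≡⟨ cong (λ z → z * B p q + + 1) 2A-1≡ ⟩
  C₂ a b * B^⊗ k s t * B p q + + 1
    ≡⟨ cong (_+ + 1) (ℤP.*-assoc (C₂ a b) (B^⊗ k s t) (B p q)) ⟩
  C₂ a b * (B^⊗ k s t * B p q) + + 1
    ≡⟨ cong (λ g → C₂ a b * g + + 1) (B^⊗-snoc k s t p q) ⟨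
  C₂ a b * B^⊗ (suc k) (snoc {k} s p) (snoc {k} t q) + + 1
    ≡⟨ ℤP.+-comm (C₂ a b * B^⊗ (suc k) (snoc {k} s p) (snoc {k} t q)) (+ 1) ⟩
  + 1 + C₂ a b * B^⊗ (suc k) (snoc {k} s p) (snoc {k} t q) ∎
  where
  open ≡-Reasoning
  A : ℤ
  A = Aseq k (combine a s) (combine b t)
  2A-1≡ : + 2 * A - + 1 ≡ C₂ a b * B^⊗ k s t
  2A-1≡ = trans (cong (_- + 1) (Aseq-entry k a b s t))
                (solve 1 (λ z → con (+ 1) :+ z :- con (+ 1) := z) refl (C₂ a b * B^⊗ k s t))

C₂-row : ∀ a g → ∑[ b < 2 ] (+ 1 + C₂ a b * g) ≡ + 2
C₂-row 0F g = solve 1 (λ g → (con (+ 1) :+ con (+ 1) :* g) :+ ((con (+ 1) :+ con (- + 1) :* g) :+ con (+ 0)) := con (+ 2)) refl g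
C₂-row 1F g = solve 1 (λ g → (con (+ 1) :+ con (- + 1) :* g) :+ ((con (+ 1) :+ con (+ 1) :* g) :+ con (+ 0)) := con (+ 2)) refl g

Aseq-rowSum : ∀ k i → rowSum (Aseq k) i ≡ + (2 ℕ.^ k)
Aseq-rowSum k = combine-induction (λ i → rowSum (Aseq k) i ≡ + (2 ℕ.^ k)) λ a s →
  trans (sumℤ≡sum (Aseq k (combine a s))) (*-cancelˡ-≢0 {+ 2} (λ ()) (begin
  + 2 * sum (Aseq k (combine a s))                          ≡⟨ sum-*ˡ (+ 2) (Aseq k (combine a s)) ⟨
  ∑[ j < 2 ℕ.^ suc k ] (+ 2 * Aseq k (combine a s) j)       ≡⟨ sum-combine {2} {n} (λ j → + 2 * Aseq k (combine a s) j) ⟩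
  ∑[ b < 2 ] ∑[ t < n ] (+ 2 * Aseq k (combine a s) (combine b t))
                                                            ≡⟨ sum-cong-≗ (λ b → sum-cong-≗ (Aseq-entry k a b s)) ⟩
  ∑[ b < 2 ] ∑[ t < n ] (+ 1 + C₂ a b * B^⊗ k s t)          ≡⟨ ∑-comm (λ b t → + 1 + C₂ a b * B^⊗ k s t) ⟩
  ∑[ t < n ] ∑[ b < 2 ] (+ 1 + C₂ a b * B^⊗ k s t)          ≡⟨ sum-cong-≗ (λ t → C₂-row a (B^⊗ k s t)) ⟩
  ∑[ t < n ] (+ 2)                                          ≡⟨ sum-const n (+ 2) ⟩
  + 2 * + n                                                 ∎))
  where
  open ≡-Reasoning
  n = 2 ℕ.^ k

-- Polynomials

eval : Poly → ℤ → ℤ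
eval []      x = + 0
eval (a ∷ p) x = a + x * eval p x

eval-+P : ∀ p q x → eval (p +P q) x ≡ eval p x + eval q x
eval-+P []      q       x = sym (ℤP.+-identityˡ _)
eval-+P (a ∷ p) []      x = sym (ℤP.+-identityʳ _)
eval-+P (a ∷ p) (b ∷ q) x = trans (cong (λ z → a + b + x * z) (eval-+P p q x))
  (solve 5 (λ a b x u v → a :+ b :+ x :* (u :+ v) := a :+ x :* u :+ (b :+ x :* v)) refl a b x (eval p x) (eval q x))

eval-scaleP : ∀ a p x → eval (scaleP a p) x ≡ a * eval p x
eval-scaleP a []      x = sym (ℤP.*-zeroʳ a)
eval-scaleP a (b ∷ p) x = trans (cong (λ z → a * b + x * z) (eval-scaleP a p x))
  (solve 4 (λ a b x u → a :* b :+ x :* (a :* u) := a :* (b :+ x :* u)) refl a b x (eval p x))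

eval-*P : ∀ p q x → eval (p *P q) x ≡ eval p x * eval q x
eval-*P []      q x = sym (ℤP.*-zeroˡ (eval q x))
eval-*P (a ∷ p) q x = begin
  eval (scaleP a q +P (+ 0 ∷ (p *P q))) x         ≡⟨ eval-+P (scaleP a q) (+ 0 ∷ (p *P q)) x ⟩
  eval (scaleP a q) x + (+ 0 + x * eval (p *P q) x)
    ≡⟨ cong₂ (λ u v → u + (+ 0 + x * v)) (eval-scaleP a q x) (eval-*P p q x) ⟩
  a * eval q x + (+ 0 + x * (eval p x * eval q x))
    ≡⟨ solve 4 (λ a x u v → a :* v :+ (con (+ 0) :+ x :* (u :* v)) := (a :+ x :* u) :* v) refl a x (eval p x) (eval q x) ⟩
  (a + x * eval p x) * eval q x                    ∎
  where open ≡-Reasoning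

eval--P : ∀ p q x → eval (p -P q) x ≡ eval p x - eval q x
eval--P p q x = trans (eval-+P p (negP q) x)
  (cong (_+_ (eval p x)) (trans (eval-scaleP (- + 1) q x) (ℤP.-1*i≡-i (eval q x))))

eval-constP : ∀ a x → eval (constP a) x ≡ a
eval-constP a x = trans (cong (_+_ a) (ℤP.*-zeroʳ x)) (ℤP.+-identityʳ a)

eval-Xp : ∀ x → eval Xp x ≡ x
eval-Xp x = solve 1 (λ x → con (+ 0) :+ x :* (con (+ 1) :+ x :* con (+ 0)) := x) refl x

eval-^P : ∀ p n x → eval (p ^P n) x ≡ eval p x ^ n
eval-^P p zero    x = eval-constP (+ 1) x
eval-^P p (suc n) x = trans (eval-*P p (p ^P n) x) (cong (eval p x *_) (eval-^P p n x))

eval-sumP : ∀ {n} (f : Fin n → Poly) x → eval (sumP f) x ≡ ∑[ i < n ] eval (f i) x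
eval-sumP {zero}  f x = refl
eval-sumP {suc n} f x = trans (eval-+P (f zero) (sumP (f ∘ suc)) x) (cong (_+_ (eval (f zero) x)) (eval-sumP (f ∘ suc) x))

eval-det : ∀ n (M : Fin n → Fin n → Poly) x → eval (det n M) x ≡ detℤ n (λ i j → eval (M i j) x)
eval-det zero    M x = eval-constP (+ 1) x
eval-det (suc n) M x = trans (eval-sumP (λ j → scaleP (sign j) (M zero j *P det n (minorP j))) x) (sum-cong-≗ λ j →
  trans (eval-scaleP (sign j) (M zero j *P det n (minorP j)) x)
        (cong (sign j *_) (trans (eval-*P (M zero j) (det n (minorP j)) x)
                                 (cong (eval (M zero j) x *_) (eval-det n (minorP j) x)))))
  where
  minorP : Fin (suc n) → Fin n → Fin n → Poly
  minorP j r c = M (suc r) (punchIn j c)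

eval-charPoly : ∀ {n} (M : Mat n) x → eval (charPoly M) x ≡ detℤ n (charMat x M)
eval-charPoly {n} M x = trans (eval-det n _ x) (detℤ-cong n λ i j → begin
  eval (scaleP (I n i j) Xp -P constP (M i j)) x           ≡⟨ eval--P (scaleP (I n i j) Xp) (constP (M i j)) x ⟩
  eval (scaleP (I n i j) Xp) x - eval (constP (M i j)) x
    ≡⟨ cong₂ _-_ (eval-scaleP (I n i j) Xp x) (eval-constP (M i j) x) ⟩
  I n i j * eval Xp x - M i j
    ≡⟨ cong (λ z → z - M i j) (trans (cong (I n i j *_) (eval-Xp x)) (ℤP.*-comm (I n i j) x)) ⟩
  x * I n i j - M i j                                      ∎)
  where open ≡-Reasoning

coeff-+P : ∀ p q i → coeff (p +P q) i ≡ coeff p i + coeff q i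
coeff-+P []      q       i       = sym (ℤP.+-identityˡ _)
coeff-+P (a ∷ p) []      i       = sym (ℤP.+-identityʳ _)
coeff-+P (a ∷ p) (b ∷ q) zero    = refl
coeff-+P (a ∷ p) (b ∷ q) (suc i) = coeff-+P p q i

coeff-scaleP : ∀ a p i → coeff (scaleP a p) i ≡ a * coeff p i
coeff-scaleP a []      i       = sym (ℤP.*-zeroʳ a)
coeff-scaleP a (b ∷ p) zero    = refl
coeff-scaleP a (b ∷ p) (suc i) = coeff-scaleP a p i

coeff--P : ∀ p q i → coeff (p -P q) i ≡ coeff p i - coeff q i
coeff--P p q i = trans (coeff-+P p (negP q) i)
  (cong (_+_ (coeff p i)) (trans (coeff-scaleP (- + 1) q i) (ℤP.-1*i≡-i (coeff q i))))

-- At x = 1 + 2|a| > |a|, the equation a = - x p(x) forces p(x) = 0 and hence a = 0.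
odd-roots⇒constant≡0 : ∀ a p → (∀ y → eval (a ∷ p) (odd y) ≡ + 0) → a ≡ + 0
odd-roots⇒constant≡0 a p roots with ∣ eval p (odd (+ ∣ a ∣)) ∣ in ∣e∣≡
... | zero  = begin
  a                      ≡⟨ ℤP.+-identityʳ a ⟨
  a + + 0                ≡⟨ cong (_+_ a) (trans (cong (x *_) (ℤP.∣i∣≡0⇒i≡0 ∣e∣≡)) (ℤP.*-zeroʳ x)) ⟨
  a + x * e              ≡⟨ roots (+ ∣ a ∣) ⟩
  + 0                    ∎
  where
  open ≡-Reasoning
  x = odd (+ ∣ a ∣)
  e = eval p x
... | suc m = ⊥-elim (ℕP.<-irrefl refl (ℕP.<-≤-trans ∣a∣<x x≤∣a∣))
  where
  x = odd (+ ∣ a ∣)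
  e = eval p x
  a≡-xe : a ≡ - (x * e)
  a≡-xe = trans (solve 2 (λ a y → a := (a :+ y) :- y) refl a (x * e))
                (trans (cong (_- (x * e)) (roots (+ ∣ a ∣))) (ℤP.+-identityˡ _))
  x≡ : x ≡ + (1 ℕ.+ 2 ℕ.* ∣ a ∣)
  x≡ = trans (cong (_+_ (+ 1)) (sym (ℤP.pos-* 2 ∣ a ∣))) (sym (ℤP.pos-+ 1 (2 ℕ.* ∣ a ∣)))
  ∣a∣≡x*∣e∣ : ∣ a ∣ ≡ (1 ℕ.+ 2 ℕ.* ∣ a ∣) ℕ.* suc m
  ∣a∣≡x*∣e∣ = trans (cong ∣_∣ a≡-xe)
                    (trans (ℤP.∣-i∣≡∣i∣ (x * e)) (trans (ℤP.abs-* x e) (cong₂ ℕ._*_ (cong ∣_∣ x≡) ∣e∣≡)))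
  ∣a∣<x : ∣ a ∣ ℕ.< 1 ℕ.+ 2 ℕ.* ∣ a ∣
  ∣a∣<x = s≤s (ℕP.m≤m+n ∣ a ∣ (∣ a ∣ ℕ.+ 0))
  x≤∣a∣ : 1 ℕ.+ 2 ℕ.* ∣ a ∣ ℕ.≤ ∣ a ∣
  x≤∣a∣ = subst (1 ℕ.+ 2 ℕ.* ∣ a ∣ ℕ.≤_) (sym ∣a∣≡x*∣e∣) (ℕP.m≤m*n _ (suc m))

odd-roots⇒zero : ∀ p → (∀ y → eval p (odd y) ≡ + 0) → ∀ i → coeff p i ≡ + 0
odd-roots⇒zero []      roots i       = refl
odd-roots⇒zero (a ∷ p) roots zero    = odd-roots⇒constant≡0 a p roots
odd-roots⇒zero (a ∷ p) roots (suc i) = odd-roots⇒zero p roots′ i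
  where
  a≡0 : a ≡ + 0
  a≡0 = odd-roots⇒constant≡0 a p roots
  roots′ : ∀ y → eval p (odd y) ≡ + 0
  roots′ y with ℤP.i*j≡0⇒i≡0∨j≡0 (odd y)
                  (trans (sym (ℤP.+-identityˡ _)) (trans (cong (_+ odd y * eval p (odd y)) (sym a≡0)) (roots y)))
  ... | inj₁ odd≡0 = ⊥-elim (odd≢0 y odd≡0)
  ... | inj₂ e≡0   = e≡0

agree-at-odd⇒≈P : ∀ p q → (∀ y → eval p (odd y) ≡ eval q (odd y)) → p ≈P q
agree-at-odd⇒≈P p q agree i = ℤP.i-j≡0⇒i≡j _ _
  (trans (sym (coeff--P p q i))
         (odd-roots⇒zero (p -P q) (λ y → trans (eval--P p q (odd y))
                                     (trans (cong (_- eval q (odd y)) (agree y)) (ℤP.+-inverseʳ (eval q (odd y))))) i))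

spectrumPoly : ℕ → ℕ → Poly
spectrumPoly N e = ((Xp -P constP (+ N)) *P (Xp ^P (N ∸ 1))) *P (((Xp ^P 2) -P constP (+ N)) ^P e)

eval-spectrumPoly : ∀ N e x → eval (spectrumPoly N e) x ≡ (x - + N) * x ^ (N ∸ 1) * (x * (x * + 1) - + N) ^ e
eval-spectrumPoly N e x = begin
  eval (spectrumPoly N e) x
    ≡⟨ eval-*P ((Xp -P constP (+ N)) *P (Xp ^P (N ∸ 1))) (((Xp ^P 2) -P constP (+ N)) ^P e) x ⟩
  eval ((Xp -P constP (+ N)) *P (Xp ^P (N ∸ 1))) x * eval (((Xp ^P 2) -P constP (+ N)) ^P e) x
    ≡⟨ cong₂ _*_ (eval-*P (Xp -P constP (+ N)) (Xp ^P (N ∸ 1)) x) (eval-^P ((Xp ^P 2) -P constP (+ N)) e x) ⟩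
  eval (Xp -P constP (+ N)) x * eval (Xp ^P (N ∸ 1)) x * eval ((Xp ^P 2) -P constP (+ N)) x ^ e
    ≡⟨ cong₂ (λ u w → u * eval (Xp ^P (N ∸ 1)) x * w ^ e) (eval-minus-N Xp) (eval-minus-N (Xp ^P 2)) ⟩
  (eval Xp x - + N) * eval (Xp ^P (N ∸ 1)) x * (eval (Xp ^P 2) x - + N) ^ e
    ≡⟨ cong₂ (λ u w → (u - + N) * eval (Xp ^P (N ∸ 1)) x * (w - + N) ^ e) (eval-Xp x) (eval-Xp^ 2) ⟩
  (x - + N) * eval (Xp ^P (N ∸ 1)) x * (x * (x * + 1) - + N) ^ e
    ≡⟨ cong (λ w → (x - + N) * w * (x * (x * + 1) - + N) ^ e) (eval-Xp^ (N ∸ 1)) ⟩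
  (x - + N) * x ^ (N ∸ 1) * (x * (x * + 1) - + N) ^ e ∎
  where
  open ≡-Reasoning
  eval-minus-N : ∀ p → eval (p -P constP (+ N)) x ≡ eval p x - + N
  eval-minus-N p = trans (eval--P p (constP (+ N)) x) (cong (_-_ (eval p x)) (eval-constP (+ N) x))
  eval-Xp^ : ∀ n → eval (Xp ^P n) x ≡ x ^ n
  eval-Xp^ n = trans (eval-^P Xp n x) (cong (_^ n) (eval-Xp x))

detℤ-charMat-Aseq : ∀ k y → let x = odd y; n = 2 ℕ.^ suc k in
  detℤ (2 ℕ.* n) (charMat x (Aseq (suc k))) ≡ (x - + n) * x ^ (n ∸ 1) * (x * (x * + 1) - + n) ^ (2 ℕ.^ k)
detℤ-charMat-Aseq k y = begin
  detℤ (2 ℕ.* n) (charMat x (Aseq (suc k)))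
    ≡⟨ detℤ-charMat-split (Aseq (suc k)) (J n) G (Aseq-entry (suc k)) x ⟩
  detℤ n (charMat x (J n)) * detℤ n (charMat x G)
    ≡⟨ cong₂ _*_ J-part G-part ⟩
  x ^ (n ∸ 1) * (x - + 1 * P) * (x * x - + 1 * + 1 * P) ^ (2 ℕ.^ k)
    ≡⟨ cong (λ p → x ^ (n ∸ 1) * (x - + 1 * p) * (x * x - + 1 * + 1 * p) ^ (2 ℕ.^ k)) (+[2^k]≡[+2]^k (suc k)) ⟨
  x ^ (n ∸ 1) * (x - + 1 * + n) * (x * x - + 1 * + 1 * + n) ^ (2 ℕ.^ k)
    ≡⟨ cong (λ z → x ^ (n ∸ 1) * (x - + 1 * + n) * z ^ (2 ℕ.^ k))
            (solve 2 (λ x p → x :* x :- con (+ 1) :* con (+ 1) :* p := x :* (x :* con (+ 1)) :- p) refl x (+ n)) ⟩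
  x ^ (n ∸ 1) * (x - + 1 * + n) * (x * (x * + 1) - + n) ^ (2 ℕ.^ k)
    ≡⟨ solve 4 (λ a x p q → a :* (x :- con (+ 1) :* p) :* q := (x :- p) :* a :* q) refl
             (x ^ (n ∸ 1)) x (+ n) ((x * (x * + 1) - + n) ^ (2 ℕ.^ k)) ⟩
  (x - + n) * x ^ (n ∸ 1) * (x * (x * + 1) - + n) ^ (2 ℕ.^ k) ∎
  where
  open ≡-Reasoning
  x = odd y
  n = 2 ℕ.^ suc k
  G : Mat n
  G = B^⊗ (suc k)
  P = (+ 2) ^ suc k
  J-part : detℤ n (charMat x (J n)) ≡ x ^ (n ∸ 1) * (x - + 1 * P)
  J-part = trans (detℤ-cong n (λ i j → cong (_-_ (x * I n i j)) (sym (ℤP.*-identityˡ (+ 1)))))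
                 (detℤ-charMat-J x (suc k) (+ 1))
  G-part : detℤ n (charMat x G) ≡ (x * x - + 1 * + 1 * P) ^ (2 ℕ.^ k)
  G-part = trans (detℤ-cong n (λ i j → solve 3 (λ x e g → x :* e :- g := x :* e :+ :- con (+ 1) :* g) refl
                                                 x (I n i j) (G i j)))
                 (detℤ-linear-B^⊗ y k (+ 1))

charPoly-Aseq : ∀ k → charPoly (Aseq (suc k)) ≈P spectrumPoly (2 ℕ.^ suc k) (2 ℕ.^ k)
charPoly-Aseq k = agree-at-odd⇒≈P (charPoly (Aseq (suc k))) (spectrumPoly (2 ℕ.^ suc k) (2 ℕ.^ k)) λ y →
  trans (eval-charPoly (Aseq (suc k)) (odd y))
        (trans (detℤ-charMat-Aseq k y) (sym (eval-spectrumPoly (2 ℕ.^ suc k) (2 ℕ.^ k) (odd y))))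

lemma17 : (k : ℕ) → 1 ≤ k →
    ((i : Fin (2 ℕ.^ suc k)) → rowSum (Aseq k) i ≡ + (2 ℕ.^ k))
    × (charPoly (Aseq k) ≈P
         (((Xp -P constP (+ (2 ℕ.^ k)))
            *P (Xp ^P ((2 ℕ.^ k) ∸ 1)))
            *P (((Xp ^P 2) -P constP (+ (2 ℕ.^ k))) ^P (2 ℕ.^ (k ∸ 1)))))
lemma17 zero    ()
lemma17 (suc k) _ = Aseq-rowSum (suc k) , charPoly-Aseq k
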